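{- Let $T$ be a reducible tree. Then there exists a tree $T'$ with $h_1(T')=h_1(T)-1$ and $h_2(T')=h_2(T)-1$ such that $\mathrm{sp}^*(T,E(T))\le \mathrm{sp}^*(T',E(T'))+1$.
   Context: A path in a graph is a sequence of distinct vertices $v_0\dots v_l$ ($l\ge0$) with consecutive ones adjacent; it contains the edges $v_{i-1}v_i$. For a family $\mathcal F$ of paths and an edge $e$, $\mathcal F(e)$ is the set of paths containing $e$. $\mathcal F$ separates $E$ if $\mathcal F(e)\neq\mathcal F(f)$ for distinct edges $e,f$, and covers $E$ if every $\mathcal F(e)$ is nonempty. $\mathrm{sp}^*(T,E(T))$ is the minimum size of a family of paths in $T$ that separates and covers $E(T)$. $h_1(T)$ is the number of leaves and $h_2(T)$ the number of degree-2 vertices of $T$. A leaf $u$ of $T$ is useful if its unique neighbour does not have degree $2$. If $u$ is a useful leaf with unique neighbour $w$ and $v$ is a vertex of degree $2$, then $(u,v)$ is a reduction pair if either $w$ has degree at least $4$, or $w$ has degree $3$ and $v$ is not a neighbour of $w$. $T$ is reducible if it has a reduction pair. -}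

module Defs where

open import Data.Nat using (ℕ; zero; suc; _+_; _≤_; _≡ᵇ_)
open import Data.Bool using (Bool; true; false; if_then_else_; T)
open import Data.Fin using (Fin)
open import Data.List using (List; []; _∷_; length; map; allFin; head; last)
open import Data.Nat.ListAction using (sum)
open import Data.Maybe using (just)
open import Data.List.Relation.Unary.Linked using (Linked)
open import Data.List.Relation.Unary.Unique.Propositional using (Unique)
open import Data.Product using (Σ; ∃; ∃-syntax; _×_; _,_)
open import Data.Sum using (_⊎_)
open import Data.Empty using (⊥)
open import Relation.Nullary using (¬_)
open import Relation.Binary.PropositionalEquality using (_≡_; _≢_)
open import Function.Bundles using (_⇔_)

record Graph : Set where
  field
    n     : ℕ
    adj   : Fin n → Fin n → Bool
    sym   : ∀ i j → adj i j ≡ adj j i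
    irrefl : ∀ i → adj i i ≡ false

module _ (G : Graph) where
  open Graph G

  Adj : Fin n → Fin n → Set
  Adj i j = T (adj i j)

  deg : Fin n → ℕ
  deg i = sum (map (λ j → if adj i j then 1 else 0) (allFin n))

  countDeg : ℕ → ℕ
  countDeg d = sum (map (λ i → if (deg i ≡ᵇ d) then 1 else 0) (allFin n))

  h₁ : ℕ
  h₁ = countDeg 1

  h₂ : ℕ
  h₂ = countDeg 2

  record Path : Set where
    field
      verts    : List (Fin n)
      nonempty : verts ≢ []
      distinct : Unique verts
      chain    : Linked Adj verts

  ContainsEdge : List (Fin n) → Fin n → Fin n → Set
  ContainsEdge [] a b = ⊥
  ContainsEdge (x ∷ []) a b = ⊥
  ContainsEdge (x ∷ y ∷ xs) a b =
    ((x ≡ a × y ≡ b) ⊎ (x ≡ b × y ≡ a)) ⊎ ContainsEdge (y ∷ xs) a b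

  _∋ₑ_─_ : Path → Fin n → Fin n → Set
  P ∋ₑ a ─ b = ContainsEdge (Path.verts P) a b

  SameEdge : Fin n → Fin n → Fin n → Fin n → Set
  SameEdge a b c d = (a ≡ c × b ≡ d) ⊎ (a ≡ d × b ≡ c)

  Family : ℕ → Set
  Family k = Fin k → Path

  SameTrace : ∀ {k} → Family k → Fin n → Fin n → Fin n → Fin n → Set
  SameTrace F a b c d = ∀ i → ((F i ∋ₑ a ─ b) ⇔ (F i ∋ₑ c ─ d))

  Separates : ∀ {k} → Family k → Set
  Separates F = ∀ a b c d → Adj a b → Adj c d → ¬ SameEdge a b c d →
                ¬ SameTrace F a b c d

  Covers : ∀ {k} → Family k → Set
  Covers F = ∀ a b → Adj a b → ∃[ i ] (F i ∋ₑ a ─ b)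

  SepCov : ℕ → Set
  SepCov k = Σ (Family k) λ F → Separates F × Covers F

  IsSpStar : ℕ → Set
  IsSpStar k = SepCov k × (∀ m → SepCov m → k ≤ m)

  _joins_and_ : Path → Fin n → Fin n → Set
  P joins u and v = head (Path.verts P) ≡ just u × last (Path.verts P) ≡ just v

  Connected : Set
  Connected = ∀ u v → ∃[ P ] (P joins u and v)

  Acyclic : Set
  Acyclic = ∀ (P : Path) u v → 3 ≤ length (Path.verts P) → P joins u and v → ¬ Adj u v

  IsTree : Set
  IsTree = Connected × Acyclic

  IsLeaf : Fin n → Set
  IsLeaf u = deg u ≡ 1

  ReductionPair : Fin n → Fin n → Set
  ReductionPair u v = IsLeaf u × deg v ≡ 2 ×
    ∃[ w ] (Adj u w × deg w ≢ 2 × (4 ≤ deg w ⊎ (deg w ≡ 3 × ¬ Adj w v)))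

  Reducible : Set
  Reducible = ∃[ u ] ∃[ v ] ReductionPair u v

record Tree : Set where
  field
    graph  : Graph
    isTree : IsTree graph

-- Let (u , v) be the reduction pair and w the neighbour of u.  Deleting the leaf u and
-- suppressing v (replacing the path a – v – b through its two neighbours by an edge a b)
-- lowers both h₁ and h₂ by one, since w keeps degree ≥ 3.  If deg w = 3, then w has degree 2
-- after the deletion and is suppressed as well; as w and v are not adjacent, the edge created
-- at v does not meet w, and again h₁ and h₂ both drop by exactly one.
--
-- Every path of the reduced tree T′ lifts to a path of T by re-inserting the suppressed
-- vertices, and an edge of T other than u w lies on a lifted path iff its image lies on the
-- original one.  The lifting identifies only pairs of edges at a suppressed vertex, so a
-- separating covering family of T′ together with one path P from u to v separates and covers
-- E(T): P covers u w, and since P ends at v (and, in the degree-3 case, runs u – w – z – …)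
-- it contains exactly one of any two edges at v (resp. at w other than u w).  Hence
-- sp*(T) ≤ sp*(T′) + 1.
module Submission where

open import Defs
open import Data.Nat using (ℕ; zero; suc; _≤_; _+_; _∸_; z≤n; s≤s; _≡ᵇ_)
open import Data.Nat.Tactic.RingSolver using (solve-∀)
open import Data.Nat.Properties using (+-commutativeSemigroup; +-identityʳ; +-comm; m≤n⇒∃[o]m+o≡n; suc-injective; ≤-trans; ≤-reflexive; n≤1+n; 1+n≰n)
open import Algebra.Properties.CommutativeSemigroup +-commutativeSemigroup using (x∙yz≈y∙xz)
open import Data.Bool using (Bool; true; false; if_then_else_; T; _∨_)
open import Data.Bool.Properties using (T-≡; T-∨; ∨-identityʳ; ∨-zeroʳ)
open import Data.Unit using (⊤; tt)
open import Data.Fin using (Fin; zero; suc; punchIn; punchOut)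
open import Data.Fin.Properties using (_≟_; punchIn-injective; punchInᵢ≢i; punchIn-punchOut)
open import Data.List using (List; []; _∷_; length; map; head; last; tabulate)
open import Data.List.Properties using (map-tabulate; length-map; head-map; last-map)
open import Data.Nat.ListAction using (sum)
open import Data.List.Membership.Propositional using (_∈_; _∉_)
open import Data.List.Membership.Propositional.Properties using (∈-map⁻)
open import Data.List.Relation.Unary.All using (All; []; _∷_)
open import Data.List.Relation.Unary.All.Properties using (All¬⇒¬Any; ¬Any⇒All¬)
open import Data.List.Relation.Unary.Any using (here; there)
open import Data.List.Relation.Unary.AllPairs using ([]; _∷_)
open import Data.List.Relation.Unary.Unique.Propositional using (Unique)
open import Data.List.Relation.Unary.Linked using (Linked; []; [-]; _∷_)
import Data.List.Relation.Unary.Linked.Properties as Linked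
import Data.List.Relation.Unary.Unique.Propositional.Properties as Unique
open import Data.Maybe using (just) renaming (map to mapᴹ)
open import Data.Maybe.Properties using (just-injective) renaming (map-injective to mapᴹ-injective)
open import Data.Product using (Σ-syntax; ∃-syntax; _×_; _,_; proj₁; proj₂)
open import Data.Sum using (_⊎_; inj₁; inj₂; [_,_]) renaming (map to map⊎)
open import Data.Empty using (⊥; ⊥-elim)
open import Relation.Nullary using (¬_; Dec; yes; no; does; _×-dec_; _⊎-dec_)
open import Relation.Nullary.Decidable using (dec-true; dec-false; does-⇔)
open import Relation.Binary.PropositionalEquality hiding ([_])
open import Function using (id; _∘_; _⇔_; mk⇔; Equivalence)
import Function.Properties.Equivalence as ⇔

T⇒≡true : ∀ {b} → T b → b ≡ true
T⇒≡true = Equivalence.to T-≡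

¬T⇒≡false : ∀ {b} → ¬ T b → b ≡ false
¬T⇒≡false {false} _ = refl
¬T⇒≡false {true} ¬t = ⊥-elim (¬t tt)

indicator : Bool → ℕ
indicator b = if b then 1 else 0

count : ∀ {n} → (Fin n → Bool) → ℕ
count f = sum (tabulate (indicator ∘ f))

count-cong : ∀ {n} {f g : Fin n → Bool} → (∀ j → f j ≡ g j) → count f ≡ count g
count-cong {zero} f≗g = refl
count-cong {suc n} f≗g = cong₂ _+_ (cong indicator (f≗g zero)) (count-cong (f≗g ∘ suc))

count-punchIn : ∀ {m} (p : Fin (suc m)) (f : Fin (suc m) → Bool) →
  count f ≡ indicator (f p) + count (f ∘ punchIn p)
count-punchIn zero f = refl
count-punchIn {suc m} (suc p) f = trans (cong (indicator (f zero) +_) (count-punchIn p (f ∘ suc)))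
  (x∙yz≈y∙xz (indicator (f zero)) (indicator (f (suc p))) _)

clear : ∀ {n} → (Fin n → Bool) → Fin n → Fin n → Bool
clear f j x = if does (x ≟ j) then false else f x

count-clear : ∀ {n} (f : Fin n → Bool) (j : Fin n) → count f ≡ indicator (f j) + count (clear f j)
count-clear {suc n} f zero = refl
count-clear {suc n} f (suc j) = trans (cong (indicator (f zero) +_) (count-clear (f ∘ suc) j))
  (x∙yz≈y∙xz (indicator (f zero)) (indicator (f (suc j))) _)

clear-cong : ∀ {n} {f g : Fin n → Bool} (j : Fin n) → (∀ x → x ≢ j → f x ≡ g x) → ∀ x → clear f j x ≡ clear g j x
clear-cong j f≗g x with x ≟ j
... | yes _ = refl
... | no x≢j = f≗g x x≢j

count-clear-T : ∀ {n} (f : Fin n → Bool) (j : Fin n) → T (f j) → count f ≡ suc (count (clear f j))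
count-clear-T f j fj = trans (count-clear f j) (cong (λ b → indicator b + count (clear f j)) (T⇒≡true fj))

count-witness : ∀ {n} (f : Fin n → Bool) {k} → count f ≡ suc k → ∃[ j ] T (f j)
count-witness {zero} f ()
count-witness {suc n} f eq with f zero in f0
... | true = zero , subst T (sym f0) tt
... | false with count-witness (f ∘ suc) eq
... | j , fj = suc j , fj

T-clear : ∀ {n} (f : Fin n → Bool) {j x : Fin n} → x ≢ j → T (f x) → T (clear f j x)
T-clear f {j} {x} x≢j fx with x ≟ j
... | yes x≡j = ⊥-elim (x≢j x≡j)
... | no _ = fx

T-clear⁻ : ∀ {n} (f : Fin n → Bool) {j x : Fin n} → T (clear f j x) → x ≢ j × T (f x)
T-clear⁻ f {j} {x} t with x ≟ j
... | no x≢j = x≢j , t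

count-∨-point : ∀ {n} (g : Fin n → Bool) (c : Fin n) → g c ≡ false →
  count (λ j → g j ∨ does (j ≟ c)) ≡ suc (count g)
count-∨-point g c gc = trans (count-clear-T h c hc) (cong suc (count-cong clear-h≗g))
  where
  h : _ → Bool
  h j = g j ∨ does (j ≟ c)
  hc : T (h c)
  hc with c ≟ c
  ... | yes _ = subst T (sym (∨-zeroʳ (g c))) tt
  ... | no c≢c = ⊥-elim (c≢c refl)
  clear-h≗g : ∀ j → clear h c j ≡ g j
  clear-h≗g j with j ≟ c
  ... | yes refl = sym gc
  ... | no _ = ∨-identityʳ (g j)

length≤count : ∀ {n} (f : Fin n → Bool) (ws : List (Fin n)) → Unique ws →
  All (T ∘ f) ws → length ws ≤ count f
length≤count f [] _ _ = z≤n
length≤count f (w ∷ ws) (w∉ws ∷ uniq) (fw ∷ fws) rewrite count-clear-T f w fw =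
  s≤s (length≤count (clear f w) ws uniq (clears w∉ws fws))
  where
  clears : ∀ {vs} → All (w ≢_) vs → All (T ∘ f) vs → All (T ∘ clear f w) vs
  clears [] [] = []
  clears (w≢v ∷ w≢vs) (fv ∷ fvs) = T-clear f (w≢v ∘ sym) fv ∷ clears w≢vs fvs

V : Graph → Set
V G = Fin (Graph.n G)

-- Vertex deletion and suppression take the graph by its adjacency data, so that its
-- vertex type is syntactically Fin (suc m) and punchIn / punchOut apply.
graph : ∀ {n} (adj : Fin n → Fin n → Bool) → (∀ i j → adj i j ≡ adj j i) → (∀ i → adj i i ≡ false) → Graph
graph {n} adj adj-sym adj-irrefl = record { n = n ; adj = adj ; sym = adj-sym ; irrefl = adj-irrefl }

module _ {A : Set} where

  last∈ : ∀ (xs : List A) {v : A} → last xs ≡ just v → v ∈ xs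
  last∈ (x ∷ []) refl = here refl
  last∈ (x ∷ y ∷ xs) e = there (last∈ (y ∷ xs) e)

  head≡just⇒≢[] : ∀ {xs : List A} {x} → head xs ≡ just x → xs ≢ []
  head≡just⇒≢[] {x ∷ xs} _ ()

  last-∷ : ∀ (a : A) (zs : List A) {v : A} → last zs ≡ just v → last (a ∷ zs) ≡ just v
  last-∷ a (z ∷ zs) e = e

  interior-neighbours : ∀ {R : A → A → Set} (xs : List A) {x : A} → Unique xs → Linked R xs → x ∈ xs →
    head xs ≢ just x → last xs ≢ just x → ∃[ y ] ∃[ z ] (y ≢ z × R y x × R x z)
  interior-neighbours (a ∷ []) _ _ (here refl) h≢ _ = ⊥-elim (h≢ refl)
  interior-neighbours (a ∷ b ∷ rest) _ _ (here refl) h≢ _ = ⊥-elim (h≢ refl)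
  interior-neighbours (a ∷ b ∷ []) _ _ (there (here refl)) _ l≢ = ⊥-elim (l≢ refl)
  interior-neighbours (a ∷ b ∷ c ∷ rest) ((_ ∷ a≢c ∷ _) ∷ _) (r ∷ r′ ∷ _) (there (here refl)) _ _ =
    a , c , a≢c , r , r′
  interior-neighbours (a ∷ b ∷ rest) (_ ∷ uniq@(b∉ ∷ _)) (_ ∷ chain) (there x∈@(there x∈rest)) _ l≢ =
    interior-neighbours (b ∷ rest) uniq chain x∈ (λ { refl → All¬⇒¬Any b∉ x∈rest }) l≢

-- SameEdge G unfolds to SamePair, which does not mention the graph and can therefore be
-- used while a graph is being defined.
SamePair : {A : Set} → A → A → A → A → Set
SamePair a b c d = (a ≡ c × b ≡ d) ⊎ (a ≡ d × b ≡ c)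

module _ {A : Set} {a b c d : A} where

  SamePair-sym : SamePair a b c d → SamePair c d a b
  SamePair-sym (inj₁ (refl , refl)) = inj₁ (refl , refl)
  SamePair-sym (inj₂ (refl , refl)) = inj₂ (refl , refl)

  SamePair-swap : SamePair a b c d → SamePair b a c d
  SamePair-swap (inj₁ (refl , refl)) = inj₂ (refl , refl)
  SamePair-swap (inj₂ (refl , refl)) = inj₁ (refl , refl)

  SamePair-trans : ∀ {e f} → SamePair a b c d → SamePair c d e f → SamePair a b e f
  SamePair-trans (inj₁ (refl , refl)) s = s
  SamePair-trans (inj₂ (refl , refl)) (inj₁ (refl , refl)) = inj₂ (refl , refl)
  SamePair-trans (inj₂ (refl , refl)) (inj₂ (refl , refl)) = inj₁ (refl , refl)

-- Opaque so that does (samePair? …) is not unfolded into Boolean connectives and stays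
-- abstractable by with.
opaque
  samePair? : ∀ {k} (a b c d : Fin k) → Dec (SamePair a b c d)
  samePair? a b c d = (a ≟ c ×-dec b ≟ d) ⊎-dec (a ≟ d ×-dec b ≟ c)

module _ (G : Graph) where
  open Graph G using (adj)

  Adj-sym : ∀ {a b} → Adj G a b → Adj G b a
  Adj-sym {a} {b} = subst T (Graph.sym G a b)

  Adj⇒≢ : ∀ {a b} → Adj G a b → a ≢ b
  Adj⇒≢ {a} ab refl = subst T (Graph.irrefl G a) ab

  ContainsEdge-resp-SameEdge : ∀ (xs : List (V G)) {a b c d} → SameEdge G a b c d →
    ContainsEdge G xs a b → ContainsEdge G xs c d
  ContainsEdge-resp-SameEdge (x ∷ y ∷ xs) (inj₁ (refl , refl)) e = e
  ContainsEdge-resp-SameEdge (x ∷ y ∷ xs) (inj₂ (refl , refl)) (inj₁ (inj₁ p)) = inj₁ (inj₂ p)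
  ContainsEdge-resp-SameEdge (x ∷ y ∷ xs) (inj₂ (refl , refl)) (inj₁ (inj₂ p)) = inj₁ (inj₁ p)
  ContainsEdge-resp-SameEdge (x ∷ y ∷ xs) s@(inj₂ (refl , refl)) (inj₂ e) =
    inj₂ (ContainsEdge-resp-SameEdge (y ∷ xs) s e)

  ContainsEdge-sym : ∀ (xs : List (V G)) {a b} → ContainsEdge G xs a b → ContainsEdge G xs b a
  ContainsEdge-sym xs = ContainsEdge-resp-SameEdge xs (inj₂ (refl , refl))

  ContainsEdge⇒∈ : ∀ (xs : List (V G)) {a b} → ContainsEdge G xs a b → a ∈ xs
  ContainsEdge⇒∈ (x ∷ y ∷ xs) (inj₁ (inj₁ (refl , _))) = here refl
  ContainsEdge⇒∈ (x ∷ y ∷ xs) (inj₁ (inj₂ (_ , refl))) = there (here refl)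
  ContainsEdge⇒∈ (x ∷ y ∷ xs) (inj₂ e) = there (ContainsEdge⇒∈ (y ∷ xs) e)

  ContainsEdge⇒Adj : ∀ (xs : List (V G)) {a b} → Linked (Adj G) xs → ContainsEdge G xs a b → Adj G a b
  ContainsEdge⇒Adj (x ∷ y ∷ xs) (r ∷ _) (inj₁ (inj₁ (refl , refl))) = r
  ContainsEdge⇒Adj (x ∷ y ∷ xs) (r ∷ _) (inj₁ (inj₂ (refl , refl))) = Adj-sym r
  ContainsEdge⇒Adj (x ∷ y ∷ xs) (_ ∷ chain) (inj₂ e) = ContainsEdge⇒Adj (y ∷ xs) chain e

  ContainsEdge-head : ∀ {x y z} xs → Unique (x ∷ y ∷ xs) → ContainsEdge G (x ∷ y ∷ xs) x z → z ≡ y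
  ContainsEdge-head xs _ (inj₁ (inj₁ (_ , refl))) = refl
  ContainsEdge-head xs ((x≢y ∷ _) ∷ _) (inj₁ (inj₂ (refl , refl))) = ⊥-elim (x≢y refl)
  ContainsEdge-head xs (x∉ ∷ _) (inj₂ e) = ⊥-elim (All¬⇒¬Any x∉ (ContainsEdge⇒∈ _ e))

  ContainsEdge-second : ∀ {x y z t} xs → Unique (x ∷ y ∷ z ∷ xs) →
    ContainsEdge G (x ∷ y ∷ z ∷ xs) y t → t ≡ x ⊎ t ≡ z
  ContainsEdge-second xs ((x≢y ∷ _) ∷ _) (inj₁ (inj₁ (refl , _))) = ⊥-elim (x≢y refl)
  ContainsEdge-second xs _ (inj₁ (inj₂ (refl , refl))) = inj₁ refl
  ContainsEdge-second xs (_ ∷ uniq) (inj₂ e) = inj₂ (ContainsEdge-head xs uniq e)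

  ContainsEdge-at-last : ∀ (xs : List (V G)) {v} → 2 ≤ length xs → last xs ≡ just v →
    ∃[ z ] ContainsEdge G xs v z
  ContainsEdge-at-last (x ∷ []) (s≤s ()) _
  ContainsEdge-at-last (x ∷ y ∷ []) _ refl = x , inj₁ (inj₂ (refl , refl))
  ContainsEdge-at-last (x ∷ y ∷ z ∷ xs) _ e with ContainsEdge-at-last (y ∷ z ∷ xs) (s≤s (s≤s z≤n)) e
  ... | t , c = t , inj₂ c

  private
    final-pair : ∀ {x y v z} rest → Unique (x ∷ y ∷ rest) → last (y ∷ rest) ≡ just v →
      SameEdge G x y v z → z ≡ x × rest ≡ []
    final-pair rest (x∉ ∷ _) e (inj₁ (refl , _)) = ⊥-elim (All¬⇒¬Any x∉ (last∈ (_ ∷ rest) e))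
    final-pair [] _ _ (inj₂ (refl , _)) = refl , refl
    final-pair (r ∷ rs) (_ ∷ (y∉ ∷ _)) e (inj₂ (_ , refl)) = ⊥-elim (All¬⇒¬Any y∉ (last∈ (r ∷ rs) e))

  ContainsEdge-at-last-unique : ∀ (xs : List (V G)) {v z z′} → Unique xs → last xs ≡ just v →
    ContainsEdge G xs v z → ContainsEdge G xs v z′ → z ≡ z′
  ContainsEdge-at-last-unique (x ∷ y ∷ rest) uniq e (inj₁ p) (inj₁ p′) =
    trans (proj₁ (final-pair rest uniq e p)) (sym (proj₁ (final-pair rest uniq e p′)))
  ContainsEdge-at-last-unique (x ∷ y ∷ rest) uniq e (inj₁ p) (inj₂ c′) with final-pair rest uniq e p
  ... | _ , refl = ⊥-elim c′
  ContainsEdge-at-last-unique (x ∷ y ∷ rest) uniq e (inj₂ c) (inj₁ p′) with final-pair rest uniq e p′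
  ... | _ , refl = ⊥-elim c
  ContainsEdge-at-last-unique (x ∷ y ∷ rest) (_ ∷ uniq) e (inj₂ c) (inj₂ c′) =
    ContainsEdge-at-last-unique (y ∷ rest) uniq e c c′

  ¬ContainsEdge-ends : ∀ (xs : List (V G)) {i j} → Unique xs → head xs ≡ just i → last xs ≡ just j →
    3 ≤ length xs → ¬ ContainsEdge G xs i j
  ¬ContainsEdge-ends (x ∷ y ∷ []) _ _ _ (s≤s (s≤s ())) _
  ¬ContainsEdge-ends (x ∷ y ∷ z ∷ rest) (_ ∷ (y∉ ∷ _)) refl e _ (inj₁ (inj₁ (_ , refl))) =
    All¬⇒¬Any y∉ (last∈ (z ∷ rest) e)
  ¬ContainsEdge-ends (x ∷ y ∷ z ∷ rest) ((x≢y ∷ _) ∷ _) refl e _ (inj₁ (inj₂ (_ , refl))) = x≢y refl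
  ¬ContainsEdge-ends (x ∷ y ∷ z ∷ rest) (x∉ ∷ _) refl e _ (inj₂ c) = All¬⇒¬Any x∉ (ContainsEdge⇒∈ _ c)

  deg≡count : ∀ v → deg G v ≡ count (adj v)
  deg≡count v = cong sum (map-tabulate (λ j → j) (indicator ∘ adj v))

  countDeg≡count : ∀ k → countDeg G k ≡ count (λ v → deg G v ≡ᵇ k)
  countDeg≡count k = cong sum (map-tabulate (λ j → j) (λ v → indicator (deg G v ≡ᵇ k)))

  distinct-neighbours≤deg : ∀ v (ws : List (V G)) → Unique ws → All (Adj G v) ws → length ws ≤ deg G v
  distinct-neighbours≤deg v ws uniq adjs =
    subst (length ws ≤_) (sym (deg≡count v)) (length≤count (adj v) ws uniq adjs)

  leaf-neighbour-unique : ∀ {u w z} → deg G u ≡ 1 → Adj G u w → Adj G u z → z ≡ w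
  leaf-neighbour-unique {u} {w} {z} leaf uw uz with z ≟ w
  ... | yes z≡w = z≡w
  ... | no z≢w = ⊥-elim (1+n≰n (subst (2 ≤_) leaf
        (distinct-neighbours≤deg u (w ∷ z ∷ []) (((z≢w ∘ sym) ∷ []) ∷ [] ∷ []) (uw ∷ uz ∷ []))))

  leaf-not-interior : ∀ {u w} → deg G u ≡ 1 → Adj G u w → ∀ (xs : List (V G)) → Unique xs →
    Linked (Adj G) xs → u ∈ xs → head xs ≢ just u → last xs ≢ just u → ⊥
  leaf-not-interior leaf uw xs uniq chain u∈ h≢ l≢ with interior-neighbours xs uniq chain u∈ h≢ l≢
  ... | y , z , y≢z , yu , uz =
    y≢z (trans (leaf-neighbour-unique leaf uw (Adj-sym yu)) (sym (leaf-neighbour-unique leaf uw uz)))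

  record DegreeTwo (v : V G) : Set where
    field
      left right : V G
      left≢right : left ≢ right
      adj-left   : Adj G v left
      adj-right  : Adj G v right
      only       : ∀ z → Adj G v z → z ≡ left ⊎ z ≡ right

  degreeTwo : ∀ v → deg G v ≡ 2 → DegreeTwo v
  degreeTwo v deg≡2 with count-witness (adj v) (trans (sym (deg≡count v)) deg≡2)
  ... | a , va with count-witness (clear (adj v) a)
                      (suc-injective (trans (sym (count-clear-T (adj v) a va)) (trans (sym (deg≡count v)) deg≡2)))
  ... | b , vb′ with T-clear⁻ (adj v) vb′
  ... | b≢a , vb = record
    { left = a ; right = b ; left≢right = b≢a ∘ sym ; adj-left = va ; adj-right = vb ; only = only }
    where
    only : ∀ z → Adj G v z → z ≡ a ⊎ z ≡ b
    only z vz with z ≟ a | z ≟ b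
    ... | yes z≡a | _ = inj₁ z≡a
    ... | no _ | yes z≡b = inj₂ z≡b
    ... | no z≢a | no z≢b = ⊥-elim (1+n≰n (subst (3 ≤_) deg≡2
          (distinct-neighbours≤deg v (a ∷ b ∷ z ∷ [])
            (((b≢a ∘ sym) ∷ (z≢a ∘ sym) ∷ []) ∷ ((z≢b ∘ sym) ∷ []) ∷ [] ∷ []) (va ∷ vb ∷ vz ∷ []))))

module _ (G H : Graph) (f : V G → V H) where

  ContainsEdge-map⁺ : ∀ (xs : List (V G)) {a b} → ContainsEdge G xs a b → ContainsEdge H (map f xs) (f a) (f b)
  ContainsEdge-map⁺ (x ∷ y ∷ xs) (inj₁ (inj₁ (refl , refl))) = inj₁ (inj₁ (refl , refl))
  ContainsEdge-map⁺ (x ∷ y ∷ xs) (inj₁ (inj₂ (refl , refl))) = inj₁ (inj₂ (refl , refl))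
  ContainsEdge-map⁺ (x ∷ y ∷ xs) (inj₂ e) = inj₂ (ContainsEdge-map⁺ (y ∷ xs) e)

  ContainsEdge-map⁻ : (∀ {x y} → f x ≡ f y → x ≡ y) → ∀ (xs : List (V G)) {a b} →
    ContainsEdge H (map f xs) (f a) (f b) → ContainsEdge G xs a b
  ContainsEdge-map⁻ f-inj (x ∷ y ∷ xs) (inj₁ (inj₁ (p , q))) = inj₁ (inj₁ (f-inj p , f-inj q))
  ContainsEdge-map⁻ f-inj (x ∷ y ∷ xs) (inj₁ (inj₂ (p , q))) = inj₁ (inj₂ (f-inj p , f-inj q))
  ContainsEdge-map⁻ f-inj (x ∷ y ∷ xs) (inj₂ e) = inj₂ (ContainsEdge-map⁻ f-inj (y ∷ xs) e)

  ContainsEdge-map-image : ∀ (xs : List (V G)) {c d} → ContainsEdge H (map f xs) c d → ∃[ a ] f a ≡ c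
  ContainsEdge-map-image (x ∷ y ∷ xs) (inj₁ (inj₁ (p , _))) = x , p
  ContainsEdge-map-image (x ∷ y ∷ xs) (inj₁ (inj₂ (_ , q))) = y , q
  ContainsEdge-map-image (x ∷ y ∷ xs) (inj₂ e) = ContainsEdge-map-image (y ∷ xs) e

punchIn-surjective-on-lists : ∀ {m} (u : Fin (suc m)) (xs : List (Fin (suc m))) → u ∉ xs →
  ∃[ ys ] map (punchIn u) ys ≡ xs
punchIn-surjective-on-lists u [] _ = [] , refl
punchIn-surjective-on-lists u (x ∷ xs) u∉ with punchIn-surjective-on-lists u xs (u∉ ∘ there)
... | ys , eq = punchOut (u∉ ∘ here) ∷ ys , cong₂ _∷_ (punchIn-punchOut _) eq

-- Separating edges at a vertex

SeparatesEdges : (G : Graph) → Path G → V G → V G → V G → V G → Set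
SeparatesEdges G P a b c d = ¬ (ContainsEdge G (Path.verts P) a b ⇔ ContainsEdge G (Path.verts P) c d)

Incident : {A : Set} → A → A → A → Set
Incident x c d = c ≡ x ⊎ d ≡ x

module _ (G : Graph) where

  edge-at : ∀ {x c d} → Adj G c d → Incident x c d → ∃[ z ] Adj G x z × SameEdge G c d x z
  edge-at cd (inj₁ refl) = _ , cd , inj₁ (refl , refl)
  edge-at cd (inj₂ refl) = _ , Adj-sym G cd , inj₂ (refl , refl)

  SeparatesEdges-resp : ∀ (P : Path G) {a b a′ b′ c d c′ d′} → SameEdge G a b a′ b′ → SameEdge G c d c′ d′ →
    SeparatesEdges G P a′ b′ c′ d′ → SeparatesEdges G P a b c d
  SeparatesEdges-resp P s t sep ab⇔cd = sep (⇔.trans (⇔.trans (same-trace (SamePair-sym s)) ab⇔cd) (same-trace t))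
    where
    same-trace : ∀ {x y x′ y′} → SameEdge G x y x′ y′ →
      ContainsEdge G (Path.verts P) x y ⇔ ContainsEdge G (Path.verts P) x′ y′
    same-trace s = mk⇔ (ContainsEdge-resp-SameEdge G _ s) (ContainsEdge-resp-SameEdge G _ (SamePair-sym s))

  separates-at : ∀ (P : Path G) x {c d e f} → Adj G c d → Adj G e f → ¬ SameEdge G c d e f →
    Incident x c d → Incident x e f →
    (∀ {z₁ z₂} → Adj G x z₁ → Adj G x z₂ → z₁ ≢ z₂ → SameEdge G c d x z₁ → SameEdge G e f x z₂ →
      SeparatesEdges G P x z₁ x z₂) →
    SeparatesEdges G P c d e f
  separates-at P x cd ef cd≠ef cd-x ef-x separates with edge-at cd cd-x | edge-at ef ef-x
  ... | z₁ , xz₁ , s₁ | z₂ , xz₂ , s₂ = SeparatesEdges-resp P s₁ s₂ (separates xz₁ xz₂ z₁≢z₂ s₁ s₂)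
    where
    z₁≢z₂ : z₁ ≢ z₂
    z₁≢z₂ refl = cd≠ef (SamePair-trans s₁ (SamePair-sym s₂))

  module _ (P : Path G) {s v} (joins : _joins_and_ G P s v) (s≢v : s ≢ v) where
    private
      vs = Path.verts P
      two-vertices : ∀ xs → head xs ≡ just s → last xs ≡ just v → 2 ≤ length xs
      two-vertices (x ∷ []) refl refl = ⊥-elim (s≢v refl)
      two-vertices (x ∷ y ∷ xs) _ _ = s≤s (s≤s z≤n)
      last-edge : ∃[ z ] ContainsEdge G vs v z
      last-edge = ContainsEdge-at-last G vs (two-vertices vs (proj₁ joins) (proj₂ joins)) (proj₂ joins)

    separates-at-end : deg G v ≤ 2 → ∀ {z₁ z₂} → Adj G v z₁ → Adj G v z₂ → z₁ ≢ z₂ → SeparatesEdges G P v z₁ v z₂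
    separates-at-end deg≤2 {z₁} {z₂} vz₁ vz₂ z₁≢z₂ vz₁⇔vz₂ with last-edge
    ... | z₀ , vz₀∈P with z₁ ≟ z₀ | z₂ ≟ z₀
    ... | yes refl | _ = z₁≢z₂
      (ContainsEdge-at-last-unique G vs (Path.distinct P) (proj₂ joins) vz₀∈P (Equivalence.to vz₁⇔vz₂ vz₀∈P))
    ... | no _ | yes refl = z₁≢z₂
      (ContainsEdge-at-last-unique G vs (Path.distinct P) (proj₂ joins) (Equivalence.from vz₁⇔vz₂ vz₀∈P) vz₀∈P)
    ... | no z₁≢z₀ | no z₂≢z₀ = 1+n≰n (≤-trans (distinct-neighbours≤deg G v (z₀ ∷ z₁ ∷ z₂ ∷ [])
        (((z₁≢z₀ ∘ sym) ∷ (z₂≢z₀ ∘ sym) ∷ []) ∷ (z₁≢z₂ ∷ []) ∷ [] ∷ [])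
        (ContainsEdge⇒Adj G vs (Path.chain P) vz₀∈P ∷ vz₁ ∷ vz₂ ∷ [])) deg≤2)

  module _ (P : Path G) {u w z rest} (eq : Path.verts P ≡ u ∷ w ∷ z ∷ rest) where
    private
      uniq : Unique (u ∷ w ∷ z ∷ rest)
      uniq = subst Unique eq (Path.distinct P)
      chain : Linked (Adj G) (u ∷ w ∷ z ∷ rest)
      chain = subst (Linked (Adj G)) eq (Path.chain P)
      wz∈P : ContainsEdge G (Path.verts P) w z
      wz∈P = subst (λ xs → ContainsEdge G xs w z) (sym eq) (inj₂ (inj₁ (inj₁ (refl , refl))))
      neighbour-on-P : ∀ {t} → ContainsEdge G (Path.verts P) w t → t ≡ u ⊎ t ≡ z
      neighbour-on-P e = ContainsEdge-second G rest uniq (subst (λ xs → ContainsEdge G xs w _) eq e)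

    separates-at-second : deg G w ≤ 3 → ∀ {z₁ z₂} → Adj G w z₁ → Adj G w z₂ → z₁ ≢ z₂ → z₁ ≢ u → z₂ ≢ u →
      SeparatesEdges G P w z₁ w z₂
    separates-at-second deg≤3 {z₁} {z₂} wz₁ wz₂ z₁≢z₂ z₁≢u z₂≢u wz₁⇔wz₂ with z₁ ≟ z | z₂ ≟ z
    ... | yes refl | _ = [ z₂≢u , z₁≢z₂ ∘ sym ] (neighbour-on-P (Equivalence.to wz₁⇔wz₂ wz∈P))
    ... | no _ | yes refl = [ z₁≢u , z₁≢z₂ ] (neighbour-on-P (Equivalence.from wz₁⇔wz₂ wz∈P))
    ... | no z₁≢z | no z₂≢z with uniq | chain
    ... | (_ ∷ u≢z ∷ _) ∷ _ | uw ∷ wz ∷ _ = 1+n≰n (≤-trans (distinct-neighbours≤deg G w (u ∷ z ∷ z₁ ∷ z₂ ∷ [])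
        ((u≢z ∷ (z₁≢u ∘ sym) ∷ (z₂≢u ∘ sym) ∷ []) ∷ ((z₁≢z ∘ sym) ∷ (z₂≢z ∘ sym) ∷ []) ∷ (z₁≢z₂ ∷ []) ∷ [] ∷ [])
        (Adj-sym G uw ∷ wz ∷ wz₁ ∷ wz₂ ∷ [])) deg≤3)

-- Lifting paths

-- Image c d c′ d′: the edge c′ d′ of G′ stands for the edge c d of G on lifted paths;
-- Defined: the edges that have an image; Merged: the pairs of distinct edges that may
-- share an image.
record PathLifting (G G′ : Graph) : Set₁ where
  field
    lift    : Path G′ → Path G
    Image   : V G → V G → V G′ → V G′ → Set
    Defined : V G → V G → Set
    Merged  : V G → V G → V G → V G → Set
    image   : ∀ {c d} → Adj G c d → Defined c d → ∃[ c′ ] ∃[ d′ ] Image c d c′ d′ × Adj G′ c′ d′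
    image-trace : ∀ {c d c′ d′} → Adj G c d → Image c d c′ d′ → ∀ P →
      ContainsEdge G (Path.verts (lift P)) c d ⇔ ContainsEdge G′ (Path.verts P) c′ d′
    image-injective : ∀ {c d e f c′ d′ e′ f′} → Adj G c d → Adj G e f → Image c d c′ d′ → Image e f e′ f′ →
      SameEdge G′ c′ d′ e′ f′ → SameEdge G c d e f ⊎ Merged c d e f

compose : ∀ {G₁ G₂ G₃} → PathLifting G₁ G₂ → PathLifting G₂ G₃ → PathLifting G₁ G₃
compose {G₁} {G₂} {G₃} L₁ L₂ = record
  { lift = L₁.lift ∘ L₂.lift
  ; Image = Image
  ; Defined = Defined
  ; Merged = Merged
  ; image = image
  ; image-trace = λ { cd (c′ , d′ , im₁ , c′d′ , im₂) P →
      ⇔.trans (L₁.image-trace cd im₁ (L₂.lift P)) (L₂.image-trace c′d′ im₂ P) }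
  ; image-injective = image-injective }
  where
  module L₁ = PathLifting L₁
  module L₂ = PathLifting L₂

  Image : V G₁ → V G₁ → V G₃ → V G₃ → Set
  Image c d c″ d″ = ∃[ c′ ] ∃[ d′ ] L₁.Image c d c′ d′ × Adj G₂ c′ d′ × L₂.Image c′ d′ c″ d″

  Defined : V G₁ → V G₁ → Set
  Defined c d = L₁.Defined c d × (∀ {c′ d′} → L₁.Image c d c′ d′ → Adj G₂ c′ d′ → L₂.Defined c′ d′)

  Merged : V G₁ → V G₁ → V G₁ → V G₁ → Set
  Merged c d e f = L₁.Merged c d e f ⊎
    (∃[ c′ ] ∃[ d′ ] ∃[ e′ ] ∃[ f′ ] L₁.Image c d c′ d′ × L₁.Image e f e′ f′ ×
                                    Adj G₂ c′ d′ × Adj G₂ e′ f′ × L₂.Merged c′ d′ e′ f′)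

  image : ∀ {c d} → Adj G₁ c d → Defined c d → ∃[ c″ ] ∃[ d″ ] Image c d c″ d″ × Adj G₃ c″ d″
  image cd (def₁ , def₂) with L₁.image cd def₁
  ... | c′ , d′ , im₁ , c′d′ with L₂.image c′d′ (def₂ im₁ c′d′)
  ... | c″ , d″ , im₂ , c″d″ = c″ , d″ , (c′ , d′ , im₁ , c′d′ , im₂) , c″d″

  image-injective : ∀ {c d e f c″ d″ e″ f″} → Adj G₁ c d → Adj G₁ e f → Image c d c″ d″ → Image e f e″ f″ →
    SameEdge G₃ c″ d″ e″ f″ → SameEdge G₁ c d e f ⊎ Merged c d e f
  image-injective cd ef (c′ , d′ , im₁ , c′d′ , im₂) (e′ , f′ , jm₁ , e′f′ , jm₂) same
    with L₂.image-injective c′d′ e′f′ im₂ jm₂ same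
  ... | inj₂ merged₂ = inj₂ (inj₂ (c′ , d′ , e′ , f′ , im₁ , jm₁ , c′d′ , e′f′ , merged₂))
  ... | inj₁ same′ = map⊎ id inj₁ (L₁.image-injective cd ef im₁ jm₁ same′)

module _ {G G′ : Graph} (L : PathLifting G G′) {u w : V G} (leaf : deg G u ≡ 1) (uw : Adj G u w)
  (defined : ∀ {c d} → Adj G c d → c ≢ u → d ≢ u → PathLifting.Defined L c d)
  (lift-avoids-u : ∀ P′ {z} → ¬ ContainsEdge G (Path.verts (PathLifting.lift L P′)) u z)
  (P : Path G) (P-uw : ContainsEdge G (Path.verts P) u w)
  (P-separates : ∀ {c d e f} → Adj G c d → Adj G e f → c ≢ u → d ≢ u → e ≢ u → f ≢ u →
    ¬ SameEdge G c d e f → PathLifting.Merged L c d e f → SeparatesEdges G P c d e f)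
  where
  open PathLifting L

  private
    at-u : ∀ {c d} → Adj G c d → Incident u c d → SameEdge G c d u w
    at-u cd (inj₁ refl) = inj₁ (refl , leaf-neighbour-unique G leaf uw cd)
    at-u cd (inj₂ refl) = inj₂ (leaf-neighbour-unique G leaf uw (Adj-sym G cd) , refl)

  extend-SepCov : ∀ {k} → SepCov G′ k → SepCov G (suc k)
  extend-SepCov {k} (F′ , separates′ , covers′) = F , separates , covers
    where
    F : Family G (suc k)
    F zero = P
    F (suc i) = lift (F′ i)

    covered : ∀ {c d} → Adj G c d → c ≢ u → d ≢ u → ∃[ i ] ContainsEdge G (Path.verts (lift (F′ i))) c d
    covered cd c≢u d≢u with image cd (defined cd c≢u d≢u)
    ... | c′ , d′ , im , c′d′ with covers′ c′ d′ c′d′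
    ... | i , e = i , Equivalence.from (image-trace cd im (F′ i)) e

    covers : Covers G F
    covers c d cd with c ≟ u | d ≟ u
    ... | yes c≡u | _ = zero , ContainsEdge-resp-SameEdge G _ (SamePair-sym (at-u cd (inj₁ c≡u))) P-uw
    ... | no _ | yes d≡u = zero , ContainsEdge-resp-SameEdge G _ (SamePair-sym (at-u cd (inj₂ d≡u))) P-uw
    ... | no c≢u | no d≢u with covered cd c≢u d≢u
    ... | i , e = suc i , e

    one-at-u : ∀ {c d e f} → Adj G c d → Adj G e f → ¬ SameEdge G c d e f → SameTrace G F c d e f →
      Incident u c d → ⊥
    one-at-u {e = e} {f} cd ef cd≠ef st cd-u with e ≟ u | f ≟ u
    ... | yes e≡u | _ = cd≠ef (SamePair-trans (at-u cd cd-u) (SamePair-sym (at-u ef (inj₁ e≡u))))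
    ... | no _ | yes f≡u = cd≠ef (SamePair-trans (at-u cd cd-u) (SamePair-sym (at-u ef (inj₂ f≡u))))
    ... | no e≢u | no f≢u with covered ef e≢u f≢u
    ... | i , ef∈ = lift-avoids-u (F′ i)
      (ContainsEdge-resp-SameEdge G _ (at-u cd cd-u) (Equivalence.from (st (suc i)) ef∈))

    separates : Separates G F
    separates c d e f cd ef cd≠ef st with c ≟ u | d ≟ u | e ≟ u | f ≟ u
    ... | yes c≡u | _ | _ | _ = one-at-u cd ef cd≠ef st (inj₁ c≡u)
    ... | _ | yes d≡u | _ | _ = one-at-u cd ef cd≠ef st (inj₂ d≡u)
    ... | _ | _ | yes e≡u | _ = one-at-u ef cd (cd≠ef ∘ SamePair-sym) (⇔.sym ∘ st) (inj₁ e≡u)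
    ... | _ | _ | _ | yes f≡u = one-at-u ef cd (cd≠ef ∘ SamePair-sym) (⇔.sym ∘ st) (inj₂ f≡u)
    ... | no c≢u | no d≢u | no e≢u | no f≢u
      with image cd (defined cd c≢u d≢u) | image ef (defined ef e≢u f≢u)
    ... | c′ , d′ , im , c′d′ | e′ , f′ , jm , e′f′ with samePair? c′ d′ e′ f′
    ...   | yes same′ = [ cd≠ef , (λ merged → P-separates cd ef c≢u d≢u e≢u f≢u cd≠ef merged (st zero)) ]
                          (image-injective cd ef im jm same′)
    ...   | no ¬same′ = separates′ c′ d′ e′ f′ c′d′ e′f′ ¬same′ λ i →
            ⇔.trans (⇔.sym (image-trace cd im (F′ i))) (⇔.trans (st (suc i)) (image-trace ef jm (F′ i)))

-- Deleting a leaf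

module DeleteVertex {m} (adj : Fin (suc m) → Fin (suc m) → Bool) (adj-sym : ∀ i j → adj i j ≡ adj j i)
  (adj-irrefl : ∀ i → adj i i ≡ false) (u : Fin (suc m)) where

  G : Graph
  G = graph adj adj-sym adj-irrefl

  ι : Fin m → Fin (suc m)
  ι = punchIn u

  ι-injective : ∀ {x y} → ι x ≡ ι y → x ≡ y
  ι-injective = punchIn-injective u _ _

  G′ : Graph
  G′ = record { n = m ; adj = λ i j → adj (ι i) (ι j) ; sym = λ i j → adj-sym (ι i) (ι j)
              ; irrefl = λ i → adj-irrefl (ι i) }

  deg-ι : ∀ i → deg G (ι i) ≡ indicator (adj (ι i) u) + deg G′ i
  deg-ι i = trans (deg≡count G (ι i))
    (trans (count-punchIn u (adj (ι i))) (cong (indicator (adj (ι i) u) +_) (sym (deg≡count G′ i))))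

  liftPath : Path G′ → Path G
  liftPath P = record
    { verts = map ι (Path.verts P)
    ; nonempty = λ eq → Path.nonempty P (map≡[] eq)
    ; distinct = Unique.map⁺ ι-injective (Path.distinct P)
    ; chain = Linked.map⁺ (Path.chain P) }
    where
    map≡[] : ∀ {xs} → map ι xs ≡ [] → xs ≡ []
    map≡[] {[]} _ = refl

  lower : (P : Path G) → u ∉ Path.verts P → Σ[ P′ ∈ Path G′ ] map ι (Path.verts P′) ≡ Path.verts P
  lower P u∉ with punchIn-surjective-on-lists u (Path.verts P) u∉
  ... | ys , refl = record
    { verts = ys
    ; nonempty = λ { refl → Path.nonempty P refl }
    ; distinct = Unique.map⁻ (Path.distinct P)
    ; chain = Linked.map⁻ (Path.chain P) } , refl

  ContainsEdge-lift : ∀ P {c d} → ContainsEdge G (Path.verts (liftPath P)) (ι c) (ι d) ⇔ ContainsEdge G′ (Path.verts P) c d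
  ContainsEdge-lift P = mk⇔ (ContainsEdge-map⁻ G′ G ι ι-injective (Path.verts P)) (ContainsEdge-map⁺ G′ G ι (Path.verts P))

  ¬ContainsEdge-lift-u : ∀ P {z} → ¬ ContainsEdge G (Path.verts (liftPath P)) u z
  ¬ContainsEdge-lift-u P e with ContainsEdge-map-image G′ G ι (Path.verts P) e
  ... | a , ιa≡u = punchInᵢ≢i u a ιa≡u

  lifting : PathLifting G G′
  lifting = record
    { lift = liftPath
    ; Image = λ c d c′ d′ → ι c′ ≡ c × ι d′ ≡ d
    ; Defined = λ c d → c ≢ u × d ≢ u
    ; Merged = λ _ _ _ _ → ⊥
    ; image = image
    ; image-trace = λ { _ (refl , refl) P → ContainsEdge-lift P }
    ; image-injective = λ { _ _ (refl , refl) (refl , refl) (inj₁ (refl , refl)) → inj₁ (inj₁ (refl , refl))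
                          ; _ _ (refl , refl) (refl , refl) (inj₂ (refl , refl)) → inj₁ (inj₂ (refl , refl)) } }
    where
    image : ∀ {c d} → Adj G c d → c ≢ u × d ≢ u → ∃[ c′ ] ∃[ d′ ] (ι c′ ≡ c × ι d′ ≡ d) × Adj G′ c′ d′
    image {c} {d} cd (c≢u , d≢u) with punchIn-punchOut (c≢u ∘ sym) | punchIn-punchOut (d≢u ∘ sym)
    ... | ιc′≡c | ιd′≡d = _ , _ , (ιc′≡c , ιd′≡d) , subst₂ (Adj G) (sym ιc′≡c) (sym ιd′≡d) cd

  module AtLeaf (tree : IsTree G) {w} (leaf : deg G u ≡ 1) (uw : Adj G u w) where

    connected : Connected G′
    connected i j with proj₁ tree (ι i) (ι j)
    ... | Q , hQ , lQ with lower Q u∉Q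
      where
      u∉Q : u ∉ Path.verts Q
      u∉Q u∈ = leaf-not-interior G leaf uw (Path.verts Q) (Path.distinct Q) (Path.chain Q) u∈
        (λ e → punchInᵢ≢i u i (just-injective (trans (sym hQ) e)))
        (λ e → punchInᵢ≢i u j (just-injective (trans (sym lQ) e)))
    ... | P , P≡Q = P , mapᴹ-injective ι-injective (trans (sym (head-map {f = ι} (Path.verts P))) (trans (cong head P≡Q) hQ))
                      , mapᴹ-injective ι-injective (trans (sym (last-map ι (Path.verts P))) (trans (cong last P≡Q) lQ))

    acyclic : Acyclic G′
    acyclic P a b len (ha , la) = proj₂ tree (liftPath P) (ι a) (ι b)
      (subst (3 ≤_) (sym (length-map ι (Path.verts P))) len)
      (trans (head-map {f = ι} (Path.verts P)) (cong (mapᴹ ι) ha) , trans (last-map ι (Path.verts P)) (cong (mapᴹ ι) la))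

    isTree : IsTree G′
    isTree = connected , acyclic

    w′ : Fin m
    w′ = punchOut (Adj⇒≢ G uw)

    ι-w′ : ι w′ ≡ w
    ι-w′ = punchIn-punchOut _

    deg-w : deg G w ≡ suc (deg G′ w′)
    deg-w = begin
      deg G w                                ≡⟨ cong (deg G) (sym ι-w′) ⟩
      deg G (ι w′)                           ≡⟨ deg-ι w′ ⟩
      indicator (adj (ι w′) u) + deg G′ w′   ≡⟨ cong (λ b → indicator b + deg G′ w′) (T⇒≡true wu) ⟩
      suc (deg G′ w′)                        ∎
      where
      open ≡-Reasoning
      wu : Adj G (ι w′) u
      wu = subst (λ x → Adj G x u) (sym ι-w′) (Adj-sym G uw)

    deg-ι-other : ∀ i → i ≢ w′ → deg G′ i ≡ deg G (ι i)
    deg-ι-other i i≢w′ = sym (trans (deg-ι i) (cong (λ b → indicator b + deg G′ i) (¬T⇒≡false ¬iu)))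
      where
      ¬iu : ¬ Adj G (ι i) u
      ¬iu iu = i≢w′ (ι-injective (trans (leaf-neighbour-unique G leaf uw (Adj-sym G iu)) (sym ι-w′)))

    -- deg G w ∸ 1 is the degree of w after the deletion; all other degrees are unchanged.
    countDeg-delete : ∀ k → countDeg G k + indicator (deg G w ∸ 1 ≡ᵇ k) ≡
                              indicator (deg G u ≡ᵇ k) + indicator (deg G w ≡ᵇ k) + countDeg G′ k
    countDeg-delete k = begin
      countDeg G k + i′        ≡⟨ cong (_+ i′) split-G ⟩
      iu + (iw + rest) + i′    ≡⟨ shuffle iu iw i′ rest ⟩
      iu + iw + (i′ + rest)    ≡⟨ cong (iu + iw +_) (sym split-G′) ⟩
      iu + iw + countDeg G′ k  ∎
      where
      open ≡-Reasoning
      i′ = indicator (deg G w ∸ 1 ≡ᵇ k)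
      iu = indicator (deg G u ≡ᵇ k)
      iw = indicator (deg G w ≡ᵇ k)
      rest = count (clear (λ j → deg G′ j ≡ᵇ k) w′)
      shuffle : ∀ a b c d → a + (b + d) + c ≡ a + b + (c + d)
      shuffle = solve-∀
      split-G : countDeg G k ≡ iu + (iw + rest)
      split-G = trans (countDeg≡count G k) (trans (count-punchIn u (λ x → deg G x ≡ᵇ k)) (cong (iu +_)
        (trans (count-clear (λ j → deg G (ι j) ≡ᵇ k) w′) (cong₂ _+_ (cong (λ x → indicator (deg G x ≡ᵇ k)) ι-w′)
          (count-cong (clear-cong w′ (λ x x≢w′ → cong (_≡ᵇ k) (sym (deg-ι-other x x≢w′)))))))))
      split-G′ : countDeg G′ k ≡ i′ + rest
      split-G′ = trans (countDeg≡count G′ k) (trans (count-clear (λ j → deg G′ j ≡ᵇ k) w′)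
        (cong (λ d → indicator (d ≡ᵇ k) + rest) (sym (cong (_∸ 1) deg-w))))

    countDeg-delete-leaf : ∀ {d} → deg G w ≡ d → ∀ k →
      countDeg G k + indicator (d ∸ 1 ≡ᵇ k) ≡ indicator (1 ≡ᵇ k) + indicator (d ≡ᵇ k) + countDeg G′ k
    countDeg-delete-leaf deg-w≡d k = subst₂
      (λ du dw → countDeg G k + indicator (dw ∸ 1 ≡ᵇ k) ≡ indicator (du ≡ᵇ k) + indicator (dw ≡ᵇ k) + countDeg G′ k)
      leaf deg-w≡d (countDeg-delete k)

-- Suppressing a vertex of degree two

module SuppressVertex {m} (adj : Fin (suc m) → Fin (suc m) → Bool) (adj-sym : ∀ i j → adj i j ≡ adj j i)
  (adj-irrefl : ∀ i → adj i i ≡ false) (p : Fin (suc m)) (two : DegreeTwo (graph adj adj-sym adj-irrefl) p) where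

  G : Graph
  G = graph adj adj-sym adj-irrefl

  ι : Fin m → Fin (suc m)
  ι = punchIn p

  ι-injective : ∀ {x y} → ι x ≡ ι y → x ≡ y
  ι-injective = punchIn-injective p _ _

  ι≢p : ∀ {c} → ι c ≢ p
  ι≢p = punchInᵢ≢i p _

  open DegreeTwo two using (left; right; adj-left; adj-right)

  a′ b′ : Fin m
  a′ = punchOut (Adj⇒≢ G adj-left)
  b′ = punchOut (Adj⇒≢ G adj-right)

  a b : Fin (suc m)
  a = ι a′
  b = ι b′

  pa : Adj G p a
  pa = subst (Adj G p) (sym (punchIn-punchOut _)) adj-left

  pb : Adj G p b
  pb = subst (Adj G p) (sym (punchIn-punchOut _)) adj-right

  a′≢b′ : a′ ≢ b′
  a′≢b′ e = DegreeTwo.left≢right two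
    (trans (sym (punchIn-punchOut _)) (trans (cong ι e) (punchIn-punchOut _)))

  p-neighbour : ∀ {i} → Adj G p (ι i) → i ≡ a′ ⊎ i ≡ b′
  p-neighbour pi = map⊎ (λ e → ι-injective (trans e (sym (punchIn-punchOut _))))
                        (λ e → ι-injective (trans e (sym (punchIn-punchOut _))))
                        (DegreeTwo.only two _ pi)

  New : Fin m → Fin m → Bool
  New i j = does (samePair? i j a′ b′)

  New⇒SamePair : ∀ {i j} → New i j ≡ true → SamePair i j a′ b′
  New⇒SamePair {i} {j} e with samePair? i j a′ b′ | e
  ... | yes s | _ = s
  ... | no _ | ()

  SamePair⇒New : ∀ {i j} → SamePair i j a′ b′ → New i j ≡ true
  SamePair⇒New = dec-true (samePair? _ _ a′ b′)

  ¬SamePair-loop : ∀ {i} → ¬ SamePair i i a′ b′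
  ¬SamePair-loop (inj₁ (refl , e)) = a′≢b′ e
  ¬SamePair-loop (inj₂ (refl , e)) = a′≢b′ (sym e)

  G′ : Graph
  G′ = record
    { n = m
    ; adj = λ i j → adj (ι i) (ι j) ∨ New i j
    ; sym = λ i j → cong₂ _∨_ (adj-sym (ι i) (ι j))
                              (does-⇔ (mk⇔ SamePair-swap SamePair-swap) (samePair? i j a′ b′) (samePair? j i a′ b′))
    ; irrefl = λ i → cong₂ _∨_ (adj-irrefl (ι i)) (dec-false (samePair? i i a′ b′) ¬SamePair-loop) }

  -- re-inserts p wherever a path of G′ uses the new edge a′ b′
  mutual
    expand : List (Fin m) → List (Fin (suc m))
    expand [] = []
    expand (x ∷ xs) = ι x ∷ expand-after x xs

    expand-after : Fin m → List (Fin m) → List (Fin (suc m))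
    expand-after x [] = []
    expand-after x (y ∷ ys) = if New x y then p ∷ expand (y ∷ ys) else expand (y ∷ ys)

  head-expand : ∀ xs {i} → head xs ≡ just i → head (expand xs) ≡ just (ι i)
  head-expand (x ∷ xs) refl = refl

  last-expand : ∀ xs {j} → last xs ≡ just j → last (expand xs) ≡ just (ι j)
  last-expand (x ∷ []) refl = refl
  -- The recursive call is made in the with-clause: inside the branches it would not pass
  -- the termination checker.
  last-expand (x ∷ y ∷ ys) e with last-expand (y ∷ ys) e | samePair? x y a′ b′
  ... | ih | yes _ = ih
  ... | ih | no _ = ih

  length≤length-expand : ∀ xs → length xs ≤ length (expand xs)
  length≤length-expand [] = z≤n
  length≤length-expand (x ∷ []) = s≤s z≤n
  length≤length-expand (x ∷ y ∷ ys) with length≤length-expand (y ∷ ys) | samePair? x y a′ b′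
  ... | ih | yes _ = s≤s (≤-trans ih (n≤1+n _))
  ... | ih | no _ = s≤s ih

  ι∈expand⇒∈ : ∀ xs {c} → ι c ∈ expand xs → c ∈ xs
  ι∈expand⇒∈ (x ∷ xs) (here e) = here (ι-injective e)
  ι∈expand⇒∈ (x ∷ y ∷ ys) (there c∈) with samePair? x y a′ b′
  ι∈expand⇒∈ (x ∷ y ∷ ys) (there (here e)) | yes _ = ⊥-elim (ι≢p e)
  ι∈expand⇒∈ (x ∷ y ∷ ys) (there (there c∈)) | yes _ = there (ι∈expand⇒∈ (y ∷ ys) c∈)
  ι∈expand⇒∈ (x ∷ y ∷ ys) (there c∈) | no _ = there (ι∈expand⇒∈ (y ∷ ys) c∈)

  p∈expand⇒new-edge : ∀ xs → p ∈ expand xs → ContainsEdge G′ xs a′ b′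
  p∈expand⇒new-edge (x ∷ xs) (here e) = ⊥-elim (ι≢p (sym e))
  p∈expand⇒new-edge (x ∷ y ∷ ys) (there p∈) with samePair? x y a′ b′
  p∈expand⇒new-edge (x ∷ y ∷ ys) (there (here _)) | yes new = inj₁ new
  p∈expand⇒new-edge (x ∷ y ∷ ys) (there (there p∈)) | yes _ = inj₂ (p∈expand⇒new-edge (y ∷ ys) p∈)
  p∈expand⇒new-edge (x ∷ y ∷ ys) (there p∈) | no _ = inj₂ (p∈expand⇒new-edge (y ∷ ys) p∈)

  expand-old : ∀ xs → ¬ ContainsEdge G′ xs a′ b′ → expand xs ≡ map ι xs
  expand-old [] _ = refl
  expand-old (x ∷ []) _ = refl
  expand-old (x ∷ y ∷ ys) ¬new with expand-old (y ∷ ys) (¬new ∘ inj₂) | samePair? x y a′ b′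
  ... | _ | yes new = ⊥-elim (¬new (inj₁ new))
  ... | ih | no _ = cong (ι x ∷_) ih

  expand-unique : ∀ xs → Unique xs → Unique (expand xs)
  expand-unique [] _ = []
  expand-unique (x ∷ []) _ = [] ∷ []
  expand-unique (x ∷ y ∷ ys) (x∉ ∷ uniq) with expand-unique (y ∷ ys) uniq | samePair? x y a′ b′
  ... | ih | yes new = ¬Any⇒All¬ _ ιx∉ ∷ ¬Any⇒All¬ _ p∉ ∷ ih
    where
    ιx∉ : ι x ∉ p ∷ expand (y ∷ ys)
    ιx∉ (here e) = ι≢p e
    ιx∉ (there ιx∈) = All¬⇒¬Any x∉ (ι∈expand⇒∈ (y ∷ ys) ιx∈)
    endpoint∈ : ∀ {z} → SamePair z y a′ b′ → ContainsEdge G′ (y ∷ ys) a′ b′ → z ∈ y ∷ ys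
    endpoint∈ (inj₁ (refl , _)) e = ContainsEdge⇒∈ G′ (y ∷ ys) e
    endpoint∈ (inj₂ (refl , _)) e = ContainsEdge⇒∈ G′ (y ∷ ys) (ContainsEdge-sym G′ (y ∷ ys) e)
    p∉ : p ∉ expand (y ∷ ys)
    p∉ = All¬⇒¬Any x∉ ∘ endpoint∈ new ∘ p∈expand⇒new-edge (y ∷ ys)
  ... | ih | no _ = ¬Any⇒All¬ _ (All¬⇒¬Any x∉ ∘ ι∈expand⇒∈ (y ∷ ys)) ∷ ih

  expand-linked : ∀ xs → Linked (Adj G′) xs → Linked (Adj G) (expand xs)
  expand-linked [] _ = []
  expand-linked (x ∷ []) _ = [-]
  expand-linked (x ∷ y ∷ ys) (xy ∷ chain) with expand-linked (y ∷ ys) chain | samePair? x y a′ b′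
  ... | ih | yes (inj₁ (refl , refl)) = Adj-sym G pa ∷ pb ∷ ih
  ... | ih | yes (inj₂ (refl , refl)) = Adj-sym G pb ∷ pa ∷ ih
  ... | ih | no _ = subst T (∨-identityʳ _) xy ∷ ih

  SamePair-endpoint : ∀ {x y z} → SamePair x y a′ b′ → z ≡ a′ ⊎ z ≡ b′ → z ≡ x ⊎ z ≡ y
  SamePair-endpoint (inj₁ (refl , refl)) = map⊎ id id
  SamePair-endpoint (inj₂ (refl , refl)) = [ inj₂ , inj₁ ]

  ContainsEdge-expand-old⁻ : ∀ xs {c d} → ContainsEdge G (expand xs) (ι c) (ι d) → ContainsEdge G′ xs c d
  ContainsEdge-expand-old⁻ (x ∷ y ∷ ys) e with samePair? x y a′ b′
  ContainsEdge-expand-old⁻ (x ∷ y ∷ ys) (inj₁ (inj₁ (_ , e))) | yes _ = ⊥-elim (ι≢p (sym e))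
  ContainsEdge-expand-old⁻ (x ∷ y ∷ ys) (inj₁ (inj₂ (_ , e))) | yes _ = ⊥-elim (ι≢p (sym e))
  ContainsEdge-expand-old⁻ (x ∷ y ∷ ys) (inj₂ (inj₁ (inj₁ (e , _)))) | yes _ = ⊥-elim (ι≢p (sym e))
  ContainsEdge-expand-old⁻ (x ∷ y ∷ ys) (inj₂ (inj₁ (inj₂ (e , _)))) | yes _ = ⊥-elim (ι≢p (sym e))
  ContainsEdge-expand-old⁻ (x ∷ y ∷ ys) (inj₂ (inj₂ e)) | yes _ = inj₂ (ContainsEdge-expand-old⁻ (y ∷ ys) e)
  ContainsEdge-expand-old⁻ (x ∷ y ∷ ys) (inj₁ (inj₁ (e , e′))) | no _ = inj₁ (inj₁ (ι-injective e , ι-injective e′))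
  ContainsEdge-expand-old⁻ (x ∷ y ∷ ys) (inj₁ (inj₂ (e , e′))) | no _ = inj₁ (inj₂ (ι-injective e , ι-injective e′))
  ContainsEdge-expand-old⁻ (x ∷ y ∷ ys) (inj₂ e) | no _ = inj₂ (ContainsEdge-expand-old⁻ (y ∷ ys) e)

  ContainsEdge-expand-old⁺ : ∀ xs {c d} → ¬ SamePair c d a′ b′ →
    ContainsEdge G′ xs c d → ContainsEdge G (expand xs) (ι c) (ι d)
  ContainsEdge-expand-old⁺ (x ∷ y ∷ ys) ¬new e with samePair? x y a′ b′
  ContainsEdge-expand-old⁺ (x ∷ y ∷ ys) ¬new (inj₁ xy) | yes new = ⊥-elim (¬new (SamePair-trans (SamePair-sym xy) new))
  ContainsEdge-expand-old⁺ (x ∷ y ∷ ys) ¬new (inj₂ e) | yes _ = inj₂ (inj₂ (ContainsEdge-expand-old⁺ (y ∷ ys) ¬new e))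
  ContainsEdge-expand-old⁺ (x ∷ y ∷ ys) ¬new (inj₁ (inj₁ (refl , refl))) | no _ = inj₁ (inj₁ (refl , refl))
  ContainsEdge-expand-old⁺ (x ∷ y ∷ ys) ¬new (inj₁ (inj₂ (refl , refl))) | no _ = inj₁ (inj₂ (refl , refl))
  ContainsEdge-expand-old⁺ (x ∷ y ∷ ys) ¬new (inj₂ e) | no _ = inj₂ (ContainsEdge-expand-old⁺ (y ∷ ys) ¬new e)

  ContainsEdge-expand-new⁻ : ∀ xs {z} → ContainsEdge G (expand xs) p (ι z) → ContainsEdge G′ xs a′ b′
  ContainsEdge-expand-new⁻ (x ∷ y ∷ ys) e with samePair? x y a′ b′
  ContainsEdge-expand-new⁻ (x ∷ y ∷ ys) (inj₂ (inj₂ e)) | yes _ = inj₂ (ContainsEdge-expand-new⁻ (y ∷ ys) e)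
  ContainsEdge-expand-new⁻ (x ∷ y ∷ ys) (inj₁ _) | yes new = inj₁ new
  ContainsEdge-expand-new⁻ (x ∷ y ∷ ys) (inj₂ (inj₁ _)) | yes new = inj₁ new
  ContainsEdge-expand-new⁻ (x ∷ y ∷ ys) (inj₁ (inj₁ (e , _))) | no _ = ⊥-elim (ι≢p e)
  ContainsEdge-expand-new⁻ (x ∷ y ∷ ys) (inj₁ (inj₂ (_ , e))) | no _ = ⊥-elim (ι≢p e)
  ContainsEdge-expand-new⁻ (x ∷ y ∷ ys) (inj₂ e) | no _ = inj₂ (ContainsEdge-expand-new⁻ (y ∷ ys) e)

  ContainsEdge-expand-new⁺ : ∀ xs {z} → z ≡ a′ ⊎ z ≡ b′ →
    ContainsEdge G′ xs a′ b′ → ContainsEdge G (expand xs) p (ι z)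
  ContainsEdge-expand-new⁺ (x ∷ y ∷ ys) z∈ab e with samePair? x y a′ b′
  ContainsEdge-expand-new⁺ (x ∷ y ∷ ys) z∈ab (inj₁ xy) | yes _ with SamePair-endpoint xy z∈ab
  ... | inj₁ refl = inj₁ (inj₂ (refl , refl))
  ... | inj₂ refl = inj₂ (inj₁ (inj₁ (refl , refl)))
  ContainsEdge-expand-new⁺ (x ∷ y ∷ ys) z∈ab (inj₂ e) | yes _ = inj₂ (inj₂ (ContainsEdge-expand-new⁺ (y ∷ ys) z∈ab e))
  ContainsEdge-expand-new⁺ (x ∷ y ∷ ys) z∈ab (inj₁ xy) | no old = ⊥-elim (old xy)
  ContainsEdge-expand-new⁺ (x ∷ y ∷ ys) z∈ab (inj₂ e) | no _ = inj₂ (ContainsEdge-expand-new⁺ (y ∷ ys) z∈ab e)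

  New-endpoint : ∀ {x′ y′} → SamePair x′ y′ a′ b′ → ∀ j → New x′ j ≡ does (j ≟ y′)
  New-endpoint (inj₁ (refl , refl)) j = does-⇔
    (mk⇔ (λ { (inj₁ (_ , e)) → e ; (inj₂ (e , _)) → ⊥-elim (a′≢b′ e) }) (λ { refl → inj₁ (refl , refl) }))
    (samePair? a′ j a′ b′) (j ≟ b′)
  New-endpoint (inj₂ (refl , refl)) j = does-⇔
    (mk⇔ (λ { (inj₁ (e , _)) → ⊥-elim (a′≢b′ (sym e)) ; (inj₂ (_ , e)) → e }) (λ { refl → inj₂ (refl , refl) }))
    (samePair? b′ j a′ b′) (j ≟ a′)

  New-other : ∀ {i} j → i ≢ a′ → i ≢ b′ → New i j ≡ false
  New-other {i} j i≢a′ i≢b′ = dec-false (samePair? i j a′ b′) λ { (inj₁ (e , _)) → i≢a′ e ; (inj₂ (e , _)) → i≢b′ e }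

  expandPath : Path G′ → Path G
  expandPath P = record
    { verts = expand (Path.verts P)
    ; nonempty = expand-nonempty (Path.verts P) (Path.nonempty P)
    ; distinct = expand-unique (Path.verts P) (Path.distinct P)
    ; chain = expand-linked (Path.verts P) (Path.chain P) }
    where
    expand-nonempty : ∀ xs → xs ≢ [] → expand xs ≢ []
    expand-nonempty [] xs≢[] = ⊥-elim (xs≢[] refl)
    expand-nonempty (x ∷ xs) _ ()

  contract-step : ∀ x → Dec (p ≡ x) → List (Fin m) → List (Fin m)
  contract-step x (yes _) r = r
  contract-step x (no p≢x) r = punchOut p≢x ∷ r

  contract : List (Fin (suc m)) → List (Fin m)
  contract [] = []
  contract (x ∷ xs) = contract-step x (p ≟ x) (contract xs)

  contract-≢ : ∀ {x} xs → p ≢ x → ∃[ x′ ] ι x′ ≡ x × contract (x ∷ xs) ≡ x′ ∷ contract xs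
  contract-≢ {x} xs p≢x with p ≟ x
  ... | yes p≡x = ⊥-elim (p≢x p≡x)
  ... | no p≢x′ = punchOut p≢x′ , punchIn-punchOut p≢x′ , refl

  contract-p : ∀ xs → contract (p ∷ xs) ≡ contract xs
  contract-p xs with p ≟ p
  ... | yes _ = refl
  ... | no p≢p = ⊥-elim (p≢p refl)

  contract-∈ : ∀ xs {c} → c ∈ contract xs → ι c ∈ xs
  contract-∈ (x ∷ xs) {c} c∈ with p ≟ x | c∈
  ... | yes _ | c∈′ = there (contract-∈ xs c∈′)
  ... | no p≢x | here refl = here (punchIn-punchOut p≢x)
  ... | no _ | there c∈′ = there (contract-∈ xs c∈′)

  contract-unique : ∀ xs → Unique xs → Unique (contract xs)
  contract-unique [] _ = []
  contract-unique (x ∷ xs) (x∉ ∷ uniq) with p ≟ x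
  ... | yes _ = contract-unique xs uniq
  ... | no p≢x = ¬Any⇒All¬ _ (All¬⇒¬Any x∉ ∘ subst (_∈ xs) (punchIn-punchOut p≢x) ∘ contract-∈ xs)
                 ∷ contract-unique xs uniq

  contract-head : ∀ xs {i} → head xs ≡ just (ι i) → head (contract xs) ≡ just i
  contract-head (x ∷ xs) {i} refl with contract-≢ xs (ι≢p ∘ sym)
  ... | x′ , ιx′≡ιi , eq = trans (cong head eq) (cong just (ι-injective ιx′≡ιi))

  contract-last : ∀ xs {j} → last xs ≡ just (ι j) → last (contract xs) ≡ just j
  contract-last (x ∷ []) {j} e with contract-≢ [] (λ p≡x → ι≢p (sym (trans p≡x (just-injective e))))
  ... | x′ , ιx′≡x , eq = trans (cong last eq) (cong just (ι-injective (trans ιx′≡x (just-injective e))))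
  contract-last (x ∷ y ∷ ys) e with contract-last (y ∷ ys) e | p ≟ x
  ... | ih | yes _ = ih
  ... | ih | no _ = last-∷ _ (contract (y ∷ ys)) ih

  neighbours⇒SamePair : ∀ {i j} → i ≡ a′ ⊎ i ≡ b′ → j ≡ a′ ⊎ j ≡ b′ → i ≢ j → SamePair i j a′ b′
  neighbours⇒SamePair (inj₁ refl) (inj₁ refl) i≢j = ⊥-elim (i≢j refl)
  neighbours⇒SamePair (inj₁ refl) (inj₂ refl) _ = inj₁ (refl , refl)
  neighbours⇒SamePair (inj₂ refl) (inj₁ refl) _ = inj₂ (refl , refl)
  neighbours⇒SamePair (inj₂ refl) (inj₂ refl) i≢j = ⊥-elim (i≢j refl)

  mutual
    contract-linked : ∀ x xs → p ≢ x → Unique (x ∷ xs) → Linked (Adj G) (x ∷ xs) → last (x ∷ xs) ≢ just p →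
      Linked (Adj G′) (contract (x ∷ xs))
    contract-linked x [] p≢x _ _ _ with contract-≢ [] p≢x
    ... | _ , _ , eq = subst (Linked (Adj G′)) (sym eq) [-]
    contract-linked x (y ∷ ys) p≢x = contract-linked-step x y ys (p ≟ y) p≢x

    contract-linked-step : ∀ x y ys → Dec (p ≡ y) → p ≢ x → Unique (x ∷ y ∷ ys) →
      Linked (Adj G) (x ∷ y ∷ ys) → last (x ∷ y ∷ ys) ≢ just p → Linked (Adj G′) (contract (x ∷ y ∷ ys))
    contract-linked-step x y ys (no p≢y) p≢x (_ ∷ uniq) (xy ∷ chain) l≢
      with contract-≢ (y ∷ ys) p≢x | contract-≢ ys p≢y
    ... | x′ , refl , eq₁ | y′ , refl , eq₂ =
      subst (Linked (Adj G′)) (sym (trans eq₁ (cong (x′ ∷_) eq₂)))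
        (Equivalence.from T-∨ (inj₁ xy) ∷ subst (Linked (Adj G′)) eq₂ (contract-linked (ι y′) ys p≢y uniq chain l≢))
    contract-linked-step x .p [] (yes refl) _ _ _ l≢ = ⊥-elim (l≢ refl)
    contract-linked-step x .p (z ∷ zs) (yes refl) p≢x ((_ ∷ x≢z ∷ _) ∷ (p≢z ∷ _) ∷ uniq) (xp ∷ pz ∷ chain) l≢
      with contract-≢ (p ∷ z ∷ zs) p≢x | contract-≢ zs p≢z
    ... | x′ , refl , eq₁ | z′ , refl , eq₂ =
      subst (Linked (Adj G′)) (sym (trans eq₁ (cong (x′ ∷_) (trans (contract-p (ι z′ ∷ zs)) eq₂))))
        (Equivalence.from T-∨ (inj₂ new) ∷ subst (Linked (Adj G′)) eq₂ (contract-linked (ι z′) zs p≢z uniq chain l≢))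
      where
      new : T (New x′ z′)
      new = Equivalence.from T-≡ (SamePair⇒New (neighbours⇒SamePair
        (p-neighbour (Adj-sym G xp)) (p-neighbour pz) (x≢z ∘ cong ι)))

  module InTree (tree : IsTree G) where

    ¬Adj-a-b : ¬ Adj G a b
    ¬Adj-a-b = proj₂ tree apb a b (s≤s (s≤s (s≤s z≤n))) (refl , refl)
      where
      apb : Path G
      apb = record
        { verts = a ∷ p ∷ b ∷ [] ; nonempty = λ ()
        ; distinct = ((Adj⇒≢ G pa ∘ sym) ∷ (a′≢b′ ∘ ι-injective) ∷ []) ∷ (Adj⇒≢ G pb ∷ []) ∷ [] ∷ []
        ; chain = Adj-sym G pa ∷ pb ∷ [-] }

    deg-ι : ∀ i → deg G′ i ≡ deg G (ι i)
    deg-ι i = begin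
      deg G′ i                                                 ≡⟨ deg≡count G′ i ⟩
      count (λ j → adj (ι i) (ι j) ∨ New i j)                  ≡⟨ count-adj′ ⟩
      indicator (adj (ι i) p) + count (λ j → adj (ι i) (ι j)) ≡⟨ sym (count-punchIn p (adj (ι i))) ⟩
      count (adj (ι i))                                        ≡⟨ sym (deg≡count G (ι i)) ⟩
      deg G (ι i)                                              ∎
      where
      open ≡-Reasoning
      count-endpoint : ∀ {y′} → SamePair i y′ a′ b′ → ¬ Adj G (ι i) (ι y′) → Adj G (ι i) p →
        count (λ j → adj (ι i) (ι j) ∨ New i j) ≡ indicator (adj (ι i) p) + count (λ j → adj (ι i) (ι j))
      count-endpoint {y′} iy′ ¬iy′ ip = begin
        count (λ j → adj (ι i) (ι j) ∨ New i j)            ≡⟨ count-cong (λ j → cong (adj (ι i) (ι j) ∨_) (New-endpoint iy′ j)) ⟩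
        count (λ j → adj (ι i) (ι j) ∨ does (j ≟ y′))      ≡⟨ count-∨-point _ y′ (¬T⇒≡false ¬iy′) ⟩
        suc (count (λ j → adj (ι i) (ι j)))                ≡⟨ cong (λ t → indicator t + count (λ j → adj (ι i) (ι j))) (sym (T⇒≡true ip)) ⟩
        indicator (adj (ι i) p) + count (λ j → adj (ι i) (ι j)) ∎
      count-adj′ : count (λ j → adj (ι i) (ι j) ∨ New i j) ≡ indicator (adj (ι i) p) + count (λ j → adj (ι i) (ι j))
      count-adj′ with i ≟ a′ | i ≟ b′
      ... | yes refl | _ = count-endpoint (inj₁ (refl , refl)) ¬Adj-a-b (Adj-sym G pa)
      ... | no _ | yes refl = count-endpoint (inj₂ (refl , refl)) (¬Adj-a-b ∘ Adj-sym G) (Adj-sym G pb)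
      ... | no i≢a′ | no i≢b′ = begin
        count (λ j → adj (ι i) (ι j) ∨ New i j)  ≡⟨ count-cong (λ j → trans (cong (adj (ι i) (ι j) ∨_) (New-other j i≢a′ i≢b′)) (∨-identityʳ (adj (ι i) (ι j)))) ⟩
        count (λ j → adj (ι i) (ι j))            ≡⟨ cong (λ t → indicator t + count (λ j → adj (ι i) (ι j))) (sym (¬T⇒≡false (λ ip → [ i≢a′ , i≢b′ ] (p-neighbour (Adj-sym G ip))))) ⟩
        indicator (adj (ι i) p) + count (λ j → adj (ι i) (ι j)) ∎

    connected : Connected G′
    connected i j with proj₁ tree (ι i) (ι j)
    ... | Q , hQ , lQ = P , contract-head (Path.verts Q) hQ , contract-last (Path.verts Q) lQ
      where
      contract-chain : ∀ xs → head xs ≡ just (ι i) → Unique xs → Linked (Adj G) xs → last xs ≢ just p →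
        Linked (Adj G′) (contract xs)
      contract-chain (x ∷ xs) refl = contract-linked (ι i) xs (ι≢p ∘ sym)
      P : Path G′
      P = record
        { verts = contract (Path.verts Q)
        ; nonempty = head≡just⇒≢[] (contract-head (Path.verts Q) hQ)
        ; distinct = contract-unique (Path.verts Q) (Path.distinct Q)
        ; chain = contract-chain (Path.verts Q) hQ (Path.distinct Q) (Path.chain Q)
                                 (λ e → ι≢p (just-injective (trans (sym lQ) e))) }

    acyclic : Acyclic G′
    acyclic P i j len (hi , lj) ij with Equivalence.to T-∨ ij
    ... | inj₁ old = proj₂ tree (expandPath P) (ι i) (ι j) (≤-trans len (length≤length-expand vs))
                       (head-expand vs hi , last-expand vs lj) old
      where vs = Path.verts P
    ... | inj₂ new = proj₂ tree Q p (ι j) (≤-trans len (≤-trans (≤-reflexive (sym (length-map ι vs))) (n≤1+n _)))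
                       (refl , last-∷ p (map ι vs) (trans (last-map ι vs) (cong (mapᴹ ι) lj))) pj
      where
      vs = Path.verts P
      ij-new : SamePair i j a′ b′
      ij-new = New⇒SamePair (T⇒≡true new)
      p-adj : ∀ {c} → c ≡ a′ ⊎ c ≡ b′ → Adj G p (ι c)
      p-adj (inj₁ refl) = pa
      p-adj (inj₂ refl) = pb
      pi : Adj G p (ι i)
      pi = p-adj (map⊎ proj₁ proj₁ ij-new)
      pj : Adj G p (ι j)
      pj = p-adj ([ inj₂ ∘ proj₂ , inj₁ ∘ proj₂ ] ij-new)
      old-path : expand vs ≡ map ι vs
      old-path = expand-old vs λ e → ¬ContainsEdge-ends G′ vs (Path.distinct P) hi lj len
        ([ (λ { (refl , refl) → e }) , (λ { (refl , refl) → ContainsEdge-sym G′ vs e }) ] ij-new)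
      Q : Path G
      Q = record
        { verts = p ∷ map ι vs ; nonempty = λ ()
        ; distinct = ¬Any⇒All¬ _ (λ p∈ → let (_ , _ , e) = ∈-map⁻ ι p∈ in ι≢p (sym e))
                     ∷ Unique.map⁺ ι-injective (Path.distinct P)
        ; chain = cons-p vs hi (subst (Linked (Adj G)) old-path (expand-linked vs (Path.chain P))) }
        where
        cons-p : ∀ xs → head xs ≡ just i → Linked (Adj G) (map ι xs) → Linked (Adj G) (p ∷ map ι xs)
        cons-p (x ∷ xs) refl chain = pi ∷ chain

    isTree : IsTree G′
    isTree = connected , acyclic

    p-neighbour′ : ∀ {d} → Adj G p d → ∃[ z ] ι z ≡ d × (z ≡ a′ ⊎ z ≡ b′)
    p-neighbour′ pd with DegreeTwo.only two _ pd
    ... | inj₁ refl = a′ , punchIn-punchOut _ , inj₁ refl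
    ... | inj₂ refl = b′ , punchIn-punchOut _ , inj₂ refl

    old-edge : ∀ {c′ d′} → Adj G (ι c′) (ι d′) → ¬ SamePair c′ d′ a′ b′
    old-edge cd (inj₁ (refl , refl)) = ¬Adj-a-b cd
    old-edge cd (inj₂ (refl , refl)) = ¬Adj-a-b (Adj-sym G cd)

    Image : V G → V G → V G′ → V G′ → Set
    Image c d c′ d′ = (ι c′ ≡ c × ι d′ ≡ d) ⊎ ((c ≡ p ⊎ d ≡ p) × c′ ≡ a′ × d′ ≡ b′)

    image : ∀ {c d} → Adj G c d → ∃[ c′ ] ∃[ d′ ] Image c d c′ d′ × Adj G′ c′ d′
    image {c} {d} cd with p ≟ c | p ≟ d
    ... | yes p≡c | _ = a′ , b′ , inj₂ (inj₁ (sym p≡c) , refl , refl) , new-ab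
      where new-ab = Equivalence.from T-∨ (inj₂ (Equivalence.from T-≡ (SamePair⇒New (inj₁ (refl , refl)))))
    ... | no _ | yes p≡d = a′ , b′ , inj₂ (inj₂ (sym p≡d) , refl , refl) , new-ab
      where new-ab = Equivalence.from T-∨ (inj₂ (Equivalence.from T-≡ (SamePair⇒New (inj₁ (refl , refl)))))
    ... | no p≢c | no p≢d with punchIn-punchOut p≢c | punchIn-punchOut p≢d
    ... | ιc′≡c | ιd′≡d = _ , _ , inj₁ (ιc′≡c , ιd′≡d) ,
      Equivalence.from T-∨ (inj₁ (subst₂ (Adj G) (sym ιc′≡c) (sym ιd′≡d) cd))

    image-trace : ∀ {c d c′ d′} → Adj G c d → Image c d c′ d′ → ∀ P →
      ContainsEdge G (Path.verts (expandPath P)) c d ⇔ ContainsEdge G′ (Path.verts P) c′ d′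
    image-trace cd (inj₁ (refl , refl)) P = mk⇔
      (ContainsEdge-expand-old⁻ (Path.verts P)) (ContainsEdge-expand-old⁺ (Path.verts P) (old-edge cd))
    image-trace cd (inj₂ (inj₁ refl , refl , refl)) P with p-neighbour′ cd
    ... | z , refl , z∈ab = mk⇔
      (ContainsEdge-expand-new⁻ (Path.verts P)) (ContainsEdge-expand-new⁺ (Path.verts P) z∈ab)
    image-trace cd (inj₂ (inj₂ refl , refl , refl)) P with p-neighbour′ (Adj-sym G cd)
    ... | z , refl , z∈ab = mk⇔
      (ContainsEdge-expand-new⁻ (Path.verts P) ∘ ContainsEdge-sym G (expand (Path.verts P)))
      (ContainsEdge-sym G (expand (Path.verts P)) ∘ ContainsEdge-expand-new⁺ (Path.verts P) z∈ab)

    image-injective : ∀ {c d e f c′ d′ e′ f′} → Adj G c d → Adj G e f → Image c d c′ d′ → Image e f e′ f′ →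
      SameEdge G′ c′ d′ e′ f′ → SameEdge G c d e f ⊎ ((c ≡ p ⊎ d ≡ p) × (e ≡ p ⊎ f ≡ p))
    image-injective _ _ (inj₁ (refl , refl)) (inj₁ (refl , refl)) (inj₁ (refl , refl)) = inj₁ (inj₁ (refl , refl))
    image-injective _ _ (inj₁ (refl , refl)) (inj₁ (refl , refl)) (inj₂ (refl , refl)) = inj₁ (inj₂ (refl , refl))
    image-injective cd _ (inj₁ (refl , refl)) (inj₂ (_ , refl , refl)) same = ⊥-elim (old-edge cd same)
    image-injective _ ef (inj₂ (_ , refl , refl)) (inj₁ (refl , refl)) same = ⊥-elim (old-edge ef (SamePair-sym same))
    image-injective _ _ (inj₂ (cd-p , _)) (inj₂ (ef-p , _)) _ = inj₂ (cd-p , ef-p)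

    Image-incident : ∀ {c d c′ d′ x} → Image c d c′ d′ → Incident x c′ d′ → ¬ Incident x a′ b′ → Incident (ι x) c d
    Image-incident (inj₁ (refl , refl)) (inj₁ refl) _ = inj₁ refl
    Image-incident (inj₁ (refl , refl)) (inj₂ refl) _ = inj₂ refl
    Image-incident (inj₂ (_ , refl , refl)) x∈c′d′ ¬x∈a′b′ = ⊥-elim (¬x∈a′b′ x∈c′d′)

    countDeg-suppress : deg G p ≡ 2 → ∀ k → countDeg G k ≡ indicator (2 ≡ᵇ k) + countDeg G′ k
    countDeg-suppress deg-p k = begin
      countDeg G k                                        ≡⟨ countDeg≡count G k ⟩
      count (λ x → deg G x ≡ᵇ k)                          ≡⟨ count-punchIn p (λ x → deg G x ≡ᵇ k) ⟩
      indicator (deg G p ≡ᵇ k) + count (λ i → deg G (ι i) ≡ᵇ k)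
        ≡⟨ cong₂ (λ d c → indicator (d ≡ᵇ k) + c) deg-p (count-cong (λ i → cong (_≡ᵇ k) (sym (deg-ι i)))) ⟩
      indicator (2 ≡ᵇ k) + count (λ i → deg G′ i ≡ᵇ k)    ≡⟨ cong (indicator (2 ≡ᵇ k) +_) (sym (countDeg≡count G′ k)) ⟩
      indicator (2 ≡ᵇ k) + countDeg G′ k                  ∎
      where open ≡-Reasoning

    lifting : PathLifting G G′
    lifting = record
      { lift = expandPath
      ; Image = Image
      ; Defined = λ _ _ → ⊤
      ; Merged = λ c d e f → (c ≡ p ⊎ d ≡ p) × (e ≡ p ⊎ f ≡ p)
      ; image = λ cd _ → image cd
      ; image-trace = image-trace
      ; image-injective = image-injective }

≡suc⇒≡∸1 : ∀ {x y} → x ≡ suc y → y ≡ x ∸ 1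
≡suc⇒≡∸1 = cong (_∸ 1) ∘ sym

SepCov-step⇒spStar≤ : ∀ {G G′} → (∀ {k} → SepCov G′ k → SepCov G (suc k)) →
  ∀ k k′ → IsSpStar G k → IsSpStar G′ k′ → k ≤ suc k′
SepCov-step⇒spStar≤ step k k′ (_ , minimal) (sepcov′ , _) = minimal (suc k′) (step sepcov′)

HasReduction : Graph → Set
HasReduction G = ∃[ T′ ] (h₁ (Tree.graph T′) ≡ h₁ G ∸ 1 × h₂ (Tree.graph T′) ≡ h₂ G ∸ 1 ×
                          (∀ k k′ → IsSpStar G k → IsSpStar (Tree.graph T′) k′ → k ≤ suc k′))

reduction-triple-distinct : ∀ G {u v w} → deg G u ≡ 1 → deg G v ≡ 2 → Adj G u w → deg G w ≢ 2 →
  u ≢ v × u ≢ w × v ≢ w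
reduction-triple-distinct G leaf deg-v uw deg-w≢2 =
  (λ { refl → 1≢2 (trans (sym leaf) deg-v) }) , Adj⇒≢ G uw , λ { refl → deg-w≢2 deg-v }
  where
  1≢2 : 1 ≢ 2
  1≢2 ()

module Reduction {m} (adj : Fin (3 + m) → Fin (3 + m) → Bool) (adj-sym : ∀ i j → adj i j ≡ adj j i)
  (adj-irrefl : ∀ i → adj i i ≡ false) where

  G : Graph
  G = graph adj adj-sym adj-irrefl

  module _ (tree : IsTree G) {u v w} (leaf : deg G u ≡ 1) (deg-v : deg G v ≡ 2) (uw : Adj G u w)
    (deg-w≢2 : deg G w ≢ 2) where

    v≢u : v ≢ u
    v≢u = ≢-sym (proj₁ (reduction-triple-distinct G leaf deg-v uw deg-w≢2))

    w≢v : w ≢ v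
    w≢v = ≢-sym (proj₂ (proj₂ (reduction-triple-distinct G leaf deg-v uw deg-w≢2)))

    module D = DeleteVertex adj adj-sym adj-irrefl u
    module DL = D.AtLeaf tree leaf uw

    G₁ : Graph
    G₁ = D.G′

    v₁ : Fin (2 + m)
    v₁ = punchOut (v≢u ∘ sym)

    ι-v₁ : D.ι v₁ ≡ v
    ι-v₁ = punchIn-punchOut _

    v₁≢w₁ : v₁ ≢ DL.w′
    v₁≢w₁ v₁≡w₁ = w≢v (trans (sym DL.ι-w′) (trans (cong D.ι (sym v₁≡w₁)) ι-v₁))

    deg-v₁ : deg G₁ v₁ ≡ 2
    deg-v₁ = trans (DL.deg-ι-other v₁ v₁≢w₁) (trans (cong (deg G) ι-v₁) deg-v)

    module S = SuppressVertex (Graph.adj G₁) (Graph.sym G₁) (Graph.irrefl G₁) v₁ (degreeTwo G₁ v₁ deg-v₁)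
    module ST = S.InTree DL.isTree

    G₂ : Graph
    G₂ = S.G′

    lifting₂ : PathLifting G G₂
    lifting₂ = compose D.lifting ST.lifting

    defined₂ : ∀ {c d} → Adj G c d → c ≢ u → d ≢ u → PathLifting.Defined lifting₂ c d
    defined₂ _ c≢u d≢u = (c≢u , d≢u) , λ _ _ → tt

    merged-at-v : ∀ {c d e f} → PathLifting.Merged lifting₂ c d e f → Incident v c d × Incident v e f
    merged-at-v (inj₂ (_ , _ , _ , _ , (refl , refl) , (refl , refl) , _ , _ , cd-v₁ , ef-v₁)) =
      to-v cd-v₁ , to-v ef-v₁
      where
      to-v : ∀ {c d} → Incident v₁ c d → Incident v (D.ι c) (D.ι d)
      to-v = map⊎ (λ e → trans (cong D.ι e) ι-v₁) (λ e → trans (cong D.ι e) ι-v₁)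

    P : Path G
    P = proj₁ (proj₁ tree u v)

    P-joins : _joins_and_ G P u v
    P-joins = proj₂ (proj₁ tree u v)

    P-shape : ∃[ rest ] Path.verts P ≡ u ∷ w ∷ rest
    P-shape = shape (Path.verts P) (Path.chain P) (proj₁ P-joins) (proj₂ P-joins)
      where
      shape : ∀ xs → Linked (Adj G) xs → head xs ≡ just u → last xs ≡ just v → ∃[ rest ] xs ≡ u ∷ w ∷ rest
      shape (x ∷ []) _ refl lt = ⊥-elim (v≢u (just-injective (sym lt)))
      shape (x ∷ y ∷ rest) (xy ∷ _) refl _ = rest , cong (λ t → u ∷ t ∷ rest) (leaf-neighbour-unique G leaf uw xy)

    P-uw : ContainsEdge G (Path.verts P) u w
    P-uw = subst (λ xs → ContainsEdge G xs u w) (sym (proj₂ P-shape)) (inj₁ (inj₁ (refl , refl)))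

    separates-at-v : ∀ {c d e f} → Adj G c d → Adj G e f → ¬ SameEdge G c d e f →
      Incident v c d → Incident v e f → SeparatesEdges G P c d e f
    separates-at-v cd ef cd≠ef cd-v ef-v = separates-at G P v cd ef cd≠ef cd-v ef-v
      λ vz₁ vz₂ z₁≢z₂ _ _ → separates-at-end G P P-joins (v≢u ∘ sym) (≤-reflexive deg-v) vz₁ vz₂ z₁≢z₂

    reduce-≥4 : 4 ≤ deg G w → HasReduction G
    reduce-≥4 4≤deg-w = record { graph = G₂ ; isTree = ST.isTree } , h₁-drop , h₂-drop ,
      SepCov-step⇒spStar≤ (extend-SepCov lifting₂ leaf uw defined₂
        (λ P′ → D.¬ContainsEdge-lift-u (S.expandPath P′)) P P-uw separates-merged)
      where
      separates-merged : ∀ {c d e f} → Adj G c d → Adj G e f → c ≢ u → d ≢ u → e ≢ u → f ≢ u →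
        ¬ SameEdge G c d e f → PathLifting.Merged lifting₂ c d e f → SeparatesEdges G P c d e f
      separates-merged cd ef _ _ _ _ cd≠ef merged =
        separates-at-v cd ef cd≠ef (proj₁ (merged-at-v merged)) (proj₂ (merged-at-v merged))
      r : ℕ
      r = proj₁ (m≤n⇒∃[o]m+o≡n 4≤deg-w)
      deg-w : deg G w ≡ 4 + r
      deg-w = sym (proj₂ (m≤n⇒∃[o]m+o≡n 4≤deg-w))
      h₁-drop : countDeg G₂ 1 ≡ countDeg G 1 ∸ 1
      h₁-drop = ≡suc⇒≡∸1 (trans (sym (+-identityʳ _))
        (trans (DL.countDeg-delete-leaf deg-w 1) (cong suc (ST.countDeg-suppress deg-v₁ 1))))
      h₂-drop : countDeg G₂ 2 ≡ countDeg G 2 ∸ 1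
      h₂-drop = ≡suc⇒≡∸1 (trans (sym (+-identityʳ _))
        (trans (DL.countDeg-delete-leaf deg-w 2) (ST.countDeg-suppress deg-v₁ 2)))

    module Degree3 (deg-w≡3 : deg G w ≡ 3) (¬wv : ¬ Adj G w v) where

      deg-w₁ : deg G₁ DL.w′ ≡ 2
      deg-w₁ = suc-injective (trans (sym DL.deg-w) deg-w≡3)

      w₂ : Fin (suc m)
      w₂ = punchOut v₁≢w₁

      ι-w₂ : S.ι w₂ ≡ DL.w′
      ι-w₂ = punchIn-punchOut v₁≢w₁

      deg-w₂ : deg G₂ w₂ ≡ 2
      deg-w₂ = trans (ST.deg-ι w₂) (trans (cong (deg G₁) ι-w₂) deg-w₁)

      module S′ = SuppressVertex (Graph.adj G₂) (Graph.sym G₂) (Graph.irrefl G₂) w₂ (degreeTwo G₂ w₂ deg-w₂)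
      module ST′ = S′.InTree ST.isTree

      lifting₃ : PathLifting G S′.G′
      lifting₃ = compose lifting₂ ST′.lifting

      defined₃ : ∀ {c d} → Adj G c d → c ≢ u → d ≢ u → PathLifting.Defined lifting₃ c d
      defined₃ cd c≢u d≢u = defined₂ cd c≢u d≢u , λ _ _ → tt

      ¬v₁w₁ : ∀ {x} → Adj G₁ v₁ (S.ι x) → x ≢ w₂
      ¬v₁w₁ v₁x refl = ¬wv (Adj-sym G (subst₂ (Adj G) ι-v₁ (trans (cong D.ι ι-w₂) DL.ι-w′) v₁x))

      -- The only use of ¬ Adj G w v: the edge created by suppressing v does not meet w.
      w₂∉a′b′ : ¬ Incident w₂ S.a′ S.b′
      w₂∉a′b′ (inj₁ a′≡w₂) = ¬v₁w₁ S.pa a′≡w₂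
      w₂∉a′b′ (inj₂ b′≡w₂) = ¬v₁w₁ S.pb b′≡w₂

      to-w : ∀ {c d c₂ d₂} → PathLifting.Image lifting₂ c d c₂ d₂ → Incident w₂ c₂ d₂ → Incident w c d
      to-w (_ , _ , (refl , refl) , _ , im) w₂-in = map⊎ (λ e → trans (cong D.ι (trans e ι-w₂)) DL.ι-w′)
        (λ e → trans (cong D.ι (trans e ι-w₂)) DL.ι-w′) (ST.Image-incident im w₂-in w₂∉a′b′)

      P-shape′ : ∃[ z ] ∃[ rest ] Path.verts P ≡ u ∷ w ∷ z ∷ rest
      P-shape′ with P-shape
      ... | [] , eq = ⊥-elim (w≢v (just-injective (trans (cong last (sym eq)) (proj₂ P-joins))))
      ... | z ∷ rest , eq = z , rest , eq

      not-u : ∀ {c d z} → SameEdge G c d w z → c ≢ u → d ≢ u → z ≢ u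
      not-u (inj₁ (_ , refl)) _ d≢u = d≢u
      not-u (inj₂ (refl , _)) c≢u _ = c≢u

      separates-merged : ∀ {c d e f} → Adj G c d → Adj G e f → c ≢ u → d ≢ u → e ≢ u → f ≢ u →
        ¬ SameEdge G c d e f → PathLifting.Merged lifting₃ c d e f → SeparatesEdges G P c d e f
      separates-merged cd ef _ _ _ _ cd≠ef (inj₁ merged) =
        separates-at-v cd ef cd≠ef (proj₁ (merged-at-v merged)) (proj₂ (merged-at-v merged))
      separates-merged cd ef c≢u d≢u e≢u f≢u cd≠ef (inj₂ (_ , _ , _ , _ , im , jm , _ , _ , cd-w₂ , ef-w₂)) =
        separates-at G P w cd ef cd≠ef (to-w im cd-w₂) (to-w jm ef-w₂) λ wz₁ wz₂ z₁≢z₂ s₁ s₂ →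
          separates-at-second G P (proj₂ (proj₂ P-shape′)) (≤-reflexive deg-w≡3) wz₁ wz₂ z₁≢z₂
            (not-u s₁ c≢u d≢u) (not-u s₂ e≢u f≢u)

      h₁-drop : countDeg S′.G′ 1 ≡ countDeg G 1 ∸ 1
      h₁-drop = ≡suc⇒≡∸1 (trans (sym (+-identityʳ _)) (trans (DL.countDeg-delete-leaf deg-w≡3 1)
        (cong suc (trans (ST.countDeg-suppress deg-v₁ 1) (ST′.countDeg-suppress deg-w₂ 1)))))

      h₂-drop : countDeg S′.G′ 2 ≡ countDeg G 2 ∸ 1
      h₂-drop = ≡suc⇒≡∸1 (suc-injective (trans (+-comm 1 _) (trans (DL.countDeg-delete-leaf deg-w≡3 2)
        (trans (ST.countDeg-suppress deg-v₁ 2) (cong suc (ST′.countDeg-suppress deg-w₂ 2))))))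

      reduce-3 : HasReduction G
      reduce-3 = record { graph = S′.G′ ; isTree = ST′.isTree } , h₁-drop , h₂-drop ,
        SepCov-step⇒spStar≤ (extend-SepCov lifting₃ leaf uw defined₃
          (λ P′ → D.¬ContainsEdge-lift-u (S.expandPath (S′.expandPath P′))) P P-uw separates-merged)

Fin2-no-three-distinct : (u v w : Fin 2) → u ≢ v → u ≢ w → v ≢ w → ⊥
Fin2-no-three-distinct zero zero _ u≢v _ _ = u≢v refl
Fin2-no-three-distinct zero (suc zero) zero _ u≢w _ = u≢w refl
Fin2-no-three-distinct zero (suc zero) (suc zero) _ _ v≢w = v≢w refl
Fin2-no-three-distinct (suc zero) zero zero _ _ v≢w = v≢w refl
Fin2-no-three-distinct (suc zero) zero (suc zero) _ u≢w _ = u≢w refl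
Fin2-no-three-distinct (suc zero) (suc zero) _ u≢v _ _ = u≢v refl

reducible⇒HasReduction : ∀ {n} (adj : Fin n → Fin n → Bool) (adj-sym : ∀ i j → adj i j ≡ adj j i)
  (adj-irrefl : ∀ i → adj i i ≡ false) → IsTree (graph adj adj-sym adj-irrefl) →
  Reducible (graph adj adj-sym adj-irrefl) → HasReduction (graph adj adj-sym adj-irrefl)
reducible⇒HasReduction {suc (suc (suc m))} adj adj-sym adj-irrefl tree
  (u , v , leaf , deg-v , w , uw , deg-w≢2 , inj₁ 4≤deg-w) =
  Reduction.reduce-≥4 adj adj-sym adj-irrefl tree leaf deg-v uw deg-w≢2 4≤deg-w
reducible⇒HasReduction {suc (suc (suc m))} adj adj-sym adj-irrefl tree
  (u , v , leaf , deg-v , w , uw , deg-w≢2 , inj₂ (deg-w≡3 , ¬wv)) =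
  Reduction.Degree3.reduce-3 adj adj-sym adj-irrefl tree leaf deg-v uw deg-w≢2 deg-w≡3 ¬wv
reducible⇒HasReduction {1} adj adj-sym adj-irrefl _ (zero , zero , leaf , deg-v , w , uw , deg-w≢2 , _) =
  ⊥-elim (proj₁ (reduction-triple-distinct (graph adj adj-sym adj-irrefl) leaf deg-v uw deg-w≢2) refl)
reducible⇒HasReduction {2} adj adj-sym adj-irrefl _ (u , v , leaf , deg-v , w , uw , deg-w≢2 , _)
  with reduction-triple-distinct (graph adj adj-sym adj-irrefl) leaf deg-v uw deg-w≢2
... | u≢v , u≢w , v≢w = ⊥-elim (Fin2-no-three-distinct u v w u≢v u≢w v≢w)

lemma5p6 : (T : Tree) → Reducible (Tree.graph T) →
  ∃[ T′ ] (h₁ (Tree.graph T′) ≡ h₁ (Tree.graph T) ∸ 1 ×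
           h₂ (Tree.graph T′) ≡ h₂ (Tree.graph T) ∸ 1 ×
           (∀ k k′ → IsSpStar (Tree.graph T) k → IsSpStar (Tree.graph T′) k′ →
              k ≤ suc k′))
lemma5p6 record { graph = record { adj = adj ; sym = adj-sym ; irrefl = adj-irrefl } ; isTree = tree } =
  reducible⇒HasReduction adj adj-sym adj-irrefl tree
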